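{- Let $x,y,n$ be odd positive integers with $n\ge3$, and let $s_p$ be an integer with $0\le s_p\le xy$ and $s_p\notin\{1,xy-1\}$. Then there is a decomposition of $\overrightarrow{C}_{(xy:n)}$ into $s_p$ $\overrightarrow{C}_{xn}$-factors and $r_p=xy-s_p$ $\overrightarrow{C}_{yn}$-factors.
   Context: For positive integers $v$ and $k\ge 3$, $\overrightarrow{C}_{(v:k)}$ is the directed graph with vertex set $\{(g,i):0\le g\le v-1,\ i\in\mathbb{Z}_k\}$ and arcs $((g,i),(h,i+1))$ for all $g,h$ and $i\in\mathbb{Z}_k$. A $\overrightarrow{C}_\ell$-factor is a spanning subgraph each of whose components is a directed cycle of length $\ell$; a decomposition is a partition of the arc set into such factors. -}

module Defs where

open import Data.Nat using (ℕ; zero; suc; _+_; _*_; _<_)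
open import Data.Fin using (Fin; toℕ)
open import Data.Product using (_×_; _,_; ∃)
open import Data.Sum using (_⊎_; inj₁; inj₂)
open import Relation.Binary.PropositionalEquality using (_≡_; _≢_)

Odd : ℕ → Set
Odd n = ∃ λ m → n ≡ suc (2 * m)

Vtx : ℕ → ℕ → Set
Vtx v k = Fin v × Fin k

IsNext : {k : ℕ} → Fin k → Fin k → Set
IsNext {k} i j = (suc (toℕ i) ≡ toℕ j) ⊎ ((suc (toℕ i) ≡ k) × (toℕ j ≡ 0))

-- arcs of C→_(v:k): ((g,i),(h,i+1)) for all g, h, i
Arc : (v k : ℕ) → Vtx v k → Vtx v k → Set
Arc v k (g , i) (h , j) = IsNext i j

iter : {A : Set} → (A → A) → ℕ → A → A
iter f zero a = a
iter f (suc n) a = f (iter f n a)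

record CycleFactor (v k ℓ : ℕ) : Set where
  field
    nxt     : Vtx v k → Vtx v k
    isArc   : ∀ u → Arc v k u (nxt u)
    closes  : ∀ u → iter nxt ℓ u ≡ u
    minimal : ∀ u j → 0 < j → j < ℓ → iter nxt j u ≢ u
open CycleFactor public

factorNxt : {v k s ℓ₁ r ℓ₂ : ℕ} → (Fin s → CycleFactor v k ℓ₁) → (Fin r → CycleFactor v k ℓ₂)
  → Fin s ⊎ Fin r → Vtx v k → Vtx v k
factorNxt F₁ F₂ (inj₁ a) = nxt (F₁ a)
factorNxt F₁ F₂ (inj₂ b) = nxt (F₂ b)

record Decomposition (v k s ℓ₁ r ℓ₂ : ℕ) : Set where
  field
    F₁ : Fin s → CycleFactor v k ℓ₁
    F₂ : Fin r → CycleFactor v k ℓ₂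
    covers : ∀ u w → Arc v k u w → ∃ λ (t : Fin s ⊎ Fin r) → factorNxt F₁ F₂ t u ≡ w
    unique : ∀ u w (t t′ : Fin s ⊎ Fin r) → factorNxt F₁ F₂ t u ≡ w → factorNxt F₁ F₂ t′ u ≡ w → t ≡ t′

-- Label the vertices by ℤₓ × ℤ_y and the levels by ℤₙ, n = 2k + 3.  Every cell
-- t of the grid ℤₓ × ℤ_y gives a 1-factor moving each vertex to the next level
-- and translating it by 2t at level 0, then alternately by −t and +t, and by −ρ(t)
-- at the last level, for a fixed permutation ρ of the cells.  At each level these
-- translations run through ℤₓ × ℤ_y exactly once, so the xy factors partition the
-- arcs, and one round of n levels translates by t − ρ(t).
--
-- The s factors of length xn come from a staircase region A of s cells: on A, ρ
-- changes only the first coordinate, by −1, +1 or −2, so t − ρ(t) generates a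
-- subgroup of order x (x is odd) and every cycle has length xn; off A, ρ changes only
-- the second coordinate, giving cycles of length yn.  Such a region, avoiding
-- segments of length one, is obtained by filling rows in row-major order; this works
-- when s ≤ x(y − 2) and s ≠ 1 (for x = 1, when s ≠ y − 1).  Otherwise the same applies
-- to the complement with x and y exchanged, unless x = y = 3, where the lengths agree.

module Submission where

open import Defs
open import Data.Nat
open import Data.Nat.Properties
open import Algebra.Properties.CommutativeSemigroup +-commutativeSemigroup using () renaming (x∙yz≈y∙xz to m+[n+o]≡n+[m+o])
open import Algebra.Properties.CommutativeSemigroup *-commutativeSemigroup using () renaming (x∙yz≈y∙xz to m*[n*o]≡n*[m*o])
open import Data.Nat.DivMod
open import Data.Nat.Divisibility using (_∣_; _∤_; ∣⇒≤; ∣m+n∣m⇒∣n; n∣m*n; ∣n⇒∣m*n; m%n≡0⇒n∣m)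
open import Data.Nat.Tactic.RingSolver using (solve-∀)
open import Data.Fin using (Fin; toℕ; fromℕ<; zero; combine; remQuot; cast; join; splitAt)
open import Data.Fin.Properties
  using (toℕ-injective; toℕ-fromℕ<; toℕ<n; remQuot-combine; combine-remQuot; toℕ-combine; *↔×; toℕ-cast; toℕ-↑ˡ; toℕ-↑ʳ; splitAt-join; join-splitAt)
  renaming (_≟_ to _≟ᶠ_)
open import Data.Product using (_×_; _,_; proj₁; proj₂; ∃)
open import Data.Product.Properties using (≡-dec)
open import Data.Sum using (_⊎_; inj₁; inj₂; swap)
open import Data.Sum.Properties using (swap-involutive)
open import Data.Empty using (⊥-elim)
open import Function using (_∘_)
open import Function.Bundles using (_↔_; Inverse; mk↔ₛ′)
open import Function.Construct.Composition using (_↔-∘_)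
open import Function.Related.TypeIsomorphisms using (×-comm)
open import Relation.Binary.Definitions using (tri<; tri≈; tri>; DecidableEquality)
open import Relation.Nullary using (¬_; yes; no)
open import Relation.Binary.PropositionalEquality
open ≡-Reasoning

-- Arithmetic modulo M on Fin M

module ZMod (M : ℕ) .{{_ : NonZero M}} where

  infixl 6 _⊕_ _⊖_

  _⊕_ : Fin M → ℕ → Fin M
  p ⊕ e = (toℕ p + e) mod M

  _⊖_ : Fin M → Fin M → Fin M
  h ⊖ p = (M ∸ toℕ p + toℕ h) mod M

  neg : Fin M → Fin M
  neg p = (M ∸ toℕ p) mod M

  toℕ-mod : ∀ e → toℕ (e mod M) ≡ e % M
  toℕ-mod e = toℕ-fromℕ< (m%n<n e M)

  toℕ-⊕ : ∀ p e → toℕ (p ⊕ e) ≡ (toℕ p + e) % M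
  toℕ-⊕ p e = toℕ-mod (toℕ p + e)

  mod-toℕ : ∀ p → toℕ p mod M ≡ p
  mod-toℕ p = toℕ-injective (trans (toℕ-mod (toℕ p)) (m<n⇒m%n≡m (toℕ<n p)))

  ⊕-identityʳ : ∀ p → p ⊕ 0 ≡ p
  ⊕-identityʳ p = trans (cong (_mod M) (+-identityʳ (toℕ p))) (mod-toℕ p)

  ⊕-% : ∀ p e → p ⊕ e % M ≡ p ⊕ e
  ⊕-% p e = toℕ-injective (begin
    toℕ (p ⊕ e % M)               ≡⟨ toℕ-⊕ p (e % M) ⟩
    (toℕ p + e % M) % M           ≡⟨ %-distribˡ-+ (toℕ p) (e % M) M ⟩
    (toℕ p % M + e % M % M) % M   ≡⟨ cong (λ z → (toℕ p % M + z) % M) (m%n%n≡m%n e M) ⟩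
    (toℕ p % M + e % M) % M       ≡⟨ %-distribˡ-+ (toℕ p) e M ⟨
    (toℕ p + e) % M               ≡⟨ toℕ-⊕ p e ⟨
    toℕ (p ⊕ e)                   ∎)

  ⊕-assoc : ∀ p e e′ → p ⊕ e ⊕ e′ ≡ p ⊕ (e + e′)
  ⊕-assoc p e e′ = toℕ-injective (begin
    toℕ (p ⊕ e ⊕ e′)              ≡⟨ toℕ-⊕ (p ⊕ e) e′ ⟩
    (toℕ (p ⊕ e) + e′) % M        ≡⟨ cong (λ z → (z + e′) % M) (toℕ-⊕ p e) ⟩
    ((toℕ p + e) % M + e′) % M    ≡⟨ %-distribˡ-+ ((toℕ p + e) % M) e′ M ⟩
    ((toℕ p + e) % M % M + e′ % M) % M ≡⟨ cong (λ z → (z + e′ % M) % M) (m%n%n≡m%n (toℕ p + e) M) ⟩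
    ((toℕ p + e) % M + e′ % M) % M ≡⟨ %-distribˡ-+ (toℕ p + e) e′ M ⟨
    (toℕ p + e + e′) % M          ≡⟨ cong (_% M) (+-assoc (toℕ p) e e′) ⟩
    (toℕ p + (e + e′)) % M        ≡⟨ toℕ-⊕ p (e + e′) ⟨
    toℕ (p ⊕ (e + e′))            ∎)

  ⊕-multiple : ∀ p k → p ⊕ k * M ≡ p
  ⊕-multiple p k = trans (sym (⊕-% p (k * M))) (trans (cong (p ⊕_) (m*n%n≡0 k M)) (⊕-identityʳ p))

  ⊖-as-⊕ : ∀ h p → toℕ (h ⊕ (M ∸ toℕ p)) ≡ toℕ (h ⊖ p)
  ⊖-as-⊕ h p = trans (toℕ-⊕ h _) (trans (cong (_% M) (+-comm (toℕ h) _)) (sym (toℕ-mod _)))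

  ⊕-⊖ : ∀ p h → p ⊕ toℕ (h ⊖ p) ≡ h
  ⊕-⊖ p h = toℕ-injective (begin
    toℕ (p ⊕ toℕ (h ⊖ p))             ≡⟨ cong toℕ (trans (cong (p ⊕_) (toℕ-mod _)) (⊕-% p _)) ⟩
    toℕ (p ⊕ (M ∸ toℕ p + toℕ h))     ≡⟨ toℕ-⊕ p _ ⟩
    (toℕ p + (M ∸ toℕ p + toℕ h)) % M ≡⟨ cong (_% M) (+-assoc (toℕ p) _ (toℕ h)) ⟨
    (toℕ p + (M ∸ toℕ p) + toℕ h) % M ≡⟨ cong (λ z → (z + toℕ h) % M) (m+[n∸m]≡n (<⇒≤ (toℕ<n p))) ⟩
    (M + toℕ h) % M                   ≡⟨ cong (_% M) (+-comm M (toℕ h)) ⟩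
    (toℕ h + M) % M                   ≡⟨ [m+n]%n≡m%n (toℕ h) M ⟩
    toℕ h % M                         ≡⟨ m<n⇒m%n≡m (toℕ<n h) ⟩
    toℕ h                             ∎)

  ⊕-undo : ∀ p e → toℕ (p ⊕ e ⊕ (M ∸ toℕ p)) ≡ e % M
  ⊕-undo p e = begin
    toℕ (p ⊕ e ⊕ (M ∸ toℕ p))         ≡⟨ cong toℕ (⊕-assoc p e _) ⟩
    toℕ (p ⊕ (e + (M ∸ toℕ p)))       ≡⟨ toℕ-⊕ p _ ⟩
    (toℕ p + (e + (M ∸ toℕ p))) % M   ≡⟨ cong (_% M) (m+[n+o]≡n+[m+o] (toℕ p) e _) ⟩
    (e + (toℕ p + (M ∸ toℕ p))) % M   ≡⟨ cong (λ z → (e + z) % M) (m+[n∸m]≡n (<⇒≤ (toℕ<n p))) ⟩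
    (e + M) % M                       ≡⟨ [m+n]%n≡m%n e M ⟩
    e % M                             ∎

  ⊕≡⇒mod≡⊖ : ∀ p e h → p ⊕ e ≡ h → e mod M ≡ h ⊖ p
  ⊕≡⇒mod≡⊖ p e h eq = toℕ-injective (begin
    toℕ (e mod M)                ≡⟨ toℕ-mod e ⟩
    e % M                        ≡⟨ ⊕-undo p e ⟨
    toℕ (p ⊕ e ⊕ (M ∸ toℕ p))    ≡⟨ cong (λ z → toℕ (z ⊕ (M ∸ toℕ p))) eq ⟩
    toℕ (h ⊕ (M ∸ toℕ p))        ≡⟨ ⊖-as-⊕ h p ⟩
    toℕ (h ⊖ p)                  ∎)

  mod≡⊖⇒⊕≡ : ∀ p e h → e mod M ≡ h ⊖ p → p ⊕ e ≡ h
  mod≡⊖⇒⊕≡ p e h eq = begin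
    p ⊕ e                 ≡⟨ ⊕-% p e ⟨
    p ⊕ e % M             ≡⟨ cong (p ⊕_) (trans (sym (toℕ-mod e)) (cong toℕ eq)) ⟩
    p ⊕ toℕ (h ⊖ p)       ≡⟨ ⊕-⊖ p h ⟩
    h                     ∎

  ⊕-fixed⇒∣ : ∀ p e → p ⊕ e ≡ p → M ∣ e
  ⊕-fixed⇒∣ p e eq = m%n≡0⇒n∣m e M (begin
    e % M                        ≡⟨ toℕ-mod e ⟨
    toℕ (e mod M)                ≡⟨ cong toℕ (⊕≡⇒mod≡⊖ p e p eq) ⟩
    toℕ (p ⊖ p)                  ≡⟨ toℕ-mod _ ⟩
    (M ∸ toℕ p + toℕ p) % M      ≡⟨ cong (_% M) (m∸n+n≡m (<⇒≤ (toℕ<n p))) ⟩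
    M % M                        ≡⟨ n%n≡0 M ⟩
    0                            ∎)

  neg-involutive-ℕ : ∀ a → a < M → (M ∸ (M ∸ a) % M) % M ≡ a
  neg-involutive-ℕ zero    _   = trans (cong (λ z → (M ∸ z) % M) (n%n≡0 M)) (n%n≡0 M)
  neg-involutive-ℕ (suc a) a<M = begin
    (M ∸ (M ∸ suc a) % M) % M ≡⟨ cong (λ z → (M ∸ z) % M) (m<n⇒m%n≡m (∸-monoʳ-< {o = 0} z<s (<⇒≤ a<M))) ⟩
    (M ∸ (M ∸ suc a)) % M     ≡⟨ cong (_% M) (m∸[m∸n]≡n (<⇒≤ a<M)) ⟩
    suc a % M                 ≡⟨ m<n⇒m%n≡m a<M ⟩
    suc a                     ∎

  neg-involutive : ∀ p → neg (neg p) ≡ p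
  neg-involutive p = toℕ-injective (begin
    toℕ (neg (neg p))            ≡⟨ toℕ-mod _ ⟩
    (M ∸ toℕ (neg p)) % M        ≡⟨ cong (λ z → (M ∸ z) % M) (toℕ-mod _) ⟩
    (M ∸ (M ∸ toℕ p) % M) % M    ≡⟨ neg-involutive-ℕ (toℕ p) (toℕ<n p) ⟩
    toℕ p                        ∎)

[1+h]*[2*z]≡z+z*[1+2h] : ∀ h z → suc h * (2 * z) ≡ z + z * suc (2 * h)
[1+h]*[2*z]≡z+z*[1+2h] = solve-∀

module ZModOdd (h : ℕ) where

  M : ℕ
  M = suc (2 * h)

  open ZMod M public

  double halve : Fin M → Fin M
  double p = (2 * toℕ p) mod M
  halve p = (suc h * toℕ p) mod M

  mul-% : ∀ a b → a * (b % M) % M ≡ a * b % M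
  mul-% a b = begin
    a * (b % M) % M             ≡⟨ %-distribˡ-* a (b % M) M ⟩
    (a % M) * (b % M % M) % M   ≡⟨ cong (λ z → (a % M) * z % M) (m%n%n≡m%n b M) ⟩
    (a % M) * (b % M) % M       ≡⟨ %-distribˡ-* a b M ⟨
    a * b % M                   ∎

  halve-double-ℕ : ∀ z → z < M → suc h * (2 * z) % M ≡ z
  halve-double-ℕ z z<M = begin
    suc h * (2 * z) % M   ≡⟨ cong (_% M) ([1+h]*[2*z]≡z+z*[1+2h] h z) ⟩
    (z + z * M) % M       ≡⟨ [m+kn]%n≡m%n z z M ⟩
    z % M                 ≡⟨ m<n⇒m%n≡m z<M ⟩
    z                     ∎

  halve-double : ∀ p → halve (double p) ≡ p
  halve-double p = toℕ-injective (begin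
    toℕ (halve (double p))        ≡⟨ toℕ-mod (suc h * toℕ (double p)) ⟩
    suc h * toℕ (double p) % M    ≡⟨ cong (λ z → suc h * z % M) (toℕ-mod (2 * toℕ p)) ⟩
    suc h * (2 * toℕ p % M) % M   ≡⟨ mul-% (suc h) (2 * toℕ p) ⟩
    suc h * (2 * toℕ p) % M       ≡⟨ halve-double-ℕ (toℕ p) (toℕ<n p) ⟩
    toℕ p                         ∎)

  double-halve : ∀ p → double (halve p) ≡ p
  double-halve p = toℕ-injective (begin
    toℕ (double (halve p))        ≡⟨ toℕ-mod (2 * toℕ (halve p)) ⟩
    2 * toℕ (halve p) % M         ≡⟨ cong (λ z → 2 * z % M) (toℕ-mod (suc h * toℕ p)) ⟩
    2 * (suc h * toℕ p % M) % M   ≡⟨ mul-% 2 (suc h * toℕ p) ⟩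
    2 * (suc h * toℕ p) % M       ≡⟨ cong (_% M) (m*[n*o]≡n*[m*o] 2 (suc h) (toℕ p)) ⟩
    suc h * (2 * toℕ p) % M       ≡⟨ halve-double-ℕ (toℕ p) (toℕ<n p) ⟩
    toℕ p                         ∎)

module _ {m : ℕ} where

  next : Fin (suc m) → Fin (suc m)
  next i with suc (toℕ i) <? suc m
  ... | yes i+1<n = fromℕ< i+1<n
  ... | no _      = zero

  wrap : Fin (suc m) → ℕ
  wrap i with suc (toℕ i) <? suc m
  ... | yes _ = 0
  ... | no _  = 1

  last-level : ∀ (i : Fin (suc m)) → ¬ suc (toℕ i) < suc m → toℕ i ≡ m
  last-level i i+1≮n = ≤-antisym (s≤s⁻¹ (toℕ<n i)) (s≤s⁻¹ (≮⇒≥ i+1≮n))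

  isNext-next : ∀ i → IsNext i (next i)
  isNext-next i with suc (toℕ i) <? suc m
  ... | yes i+1<n = inj₁ (sym (toℕ-fromℕ< i+1<n))
  ... | no i+1≮n  = inj₂ (cong suc (last-level i i+1≮n) , refl)

  isNext⇒≡next : ∀ i j → IsNext i j → j ≡ next i
  isNext⇒≡next i j i→j with suc (toℕ i) <? suc m | i→j
  ... | yes i+1<n | inj₁ e       = toℕ-injective (trans (sym e) (sym (toℕ-fromℕ< i+1<n)))
  ... | yes i+1<n | inj₂ (e , _) = ⊥-elim (<-irrefl e i+1<n)
  ... | no i+1≮n  | inj₁ e       = ⊥-elim (i+1≮n (subst (_< suc m) (sym e) (toℕ<n j)))
  ... | no _      | inj₂ (_ , e) = toℕ-injective e

  toℕ-next : ∀ i → toℕ (next i) + wrap i * suc m ≡ suc (toℕ i)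
  toℕ-next i with suc (toℕ i) <? suc m
  ... | yes i+1<n = trans (+-identityʳ _) (toℕ-fromℕ< i+1<n)
  ... | no i+1≮n  = cong suc (trans (+-identityʳ m) (sym (last-level i i+1≮n)))

prefixSum : (ℕ → ℕ) → ℕ → ℕ
prefixSum d zero    = 0
prefixSum d (suc l) = prefixSum d l + d l

prefixSum-next : ∀ {m} d (i : Fin (suc m)) →
  prefixSum d (suc (toℕ i)) ≡ prefixSum d (toℕ (next i)) + wrap i * prefixSum d (suc m)
prefixSum-next {m} d i with suc (toℕ i) <? suc m
... | yes i+1<n = trans (cong (prefixSum d) (sym (toℕ-fromℕ< i+1<n))) (sym (+-identityʳ _))
... | no i+1≮n  = trans (cong (prefixSum d ∘ suc) (last-level i i+1≮n)) (sym (+-identityʳ _))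

remainder-unique : ∀ {a b k l} n .{{_ : NonZero n}} → a < n → b < n →
  a + k * n ≡ b + l * n → a ≡ b × k ≡ l
remainder-unique {a} {b} {k} {l} n a<n b<n eq = a≡b , *-cancelʳ-≡ k l n (+-cancelˡ-≡ a _ _ (trans eq (cong (_+ l * n) (sym a≡b))))
  where
  a≡b : a ≡ b
  a≡b = begin
    a                ≡⟨ m<n⇒m%n≡m a<n ⟨
    a % n            ≡⟨ [m+kn]%n≡m%n a k n ⟨
    (a + k * n) % n  ≡⟨ cong (_% n) eq ⟩
    (b + l * n) % n  ≡⟨ [m+kn]%n≡m%n b l n ⟩
    b % n            ≡⟨ m<n⇒m%n≡m b<n ⟩
    b                ∎

UniformCycles : {A : Set} → (A → A) → ℕ → Set
UniformCycles f ℓ = (∀ u → iter f ℓ u ≡ u) × (∀ u j → 0 < j → j < ℓ → iter f j u ≢ u)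

module Walk {V : Set} (act : ℕ → ℕ → V → V)
  (act-zero : ∀ g → act 0 0 g ≡ g)
  (act-+ : ∀ a b a′ b′ g → act a b (act a′ b′ g) ≡ act (a′ + a) (b′ + b) g)
  (n′ : ℕ) (d₁ d₂ : ℕ → ℕ) where

  n : ℕ
  n = suc n′

  step : V × Fin n → V × Fin n
  step (g , i) = act (d₁ (toℕ i)) (d₂ (toℕ i)) g , next i

  wraps : ℕ → Fin n → ℕ
  wraps zero    i = 0
  wraps (suc j) i = wraps j i + wrap (iter next j i)

  displacement : (ℕ → ℕ) → ℕ → Fin n → ℕ
  displacement d zero    i = 0
  displacement d (suc j) i = displacement d j i + d (toℕ (iter next j i))

  iter-step : ∀ j g i → iter step j (g , i) ≡ (act (displacement d₁ j i) (displacement d₂ j i) g , iter next j i)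
  iter-step zero    g i = cong (_, i) (sym (act-zero g))
  iter-step (suc j) g i = begin
    step (iter step j (g , i))                                               ≡⟨ cong step (iter-step j g i) ⟩
    step (act (displacement d₁ j i) (displacement d₂ j i) g , iter next j i) ≡⟨ cong (_, _) (act-+ _ _ _ _ g) ⟩
    (act (displacement d₁ (suc j) i) (displacement d₂ (suc j) i) g , iter next (suc j) i) ∎

  level-wraps : ∀ j i → toℕ (iter next j i) + wraps j i * n ≡ toℕ i + j
  level-wraps zero    i = refl
  level-wraps (suc j) i = begin
    toℕ (next l) + (wraps j i + wrap l) * n        ≡⟨ cong (toℕ (next l) +_) (*-distribʳ-+ n (wraps j i) (wrap l)) ⟩
    toℕ (next l) + (wraps j i * n + wrap l * n)    ≡⟨ cong (toℕ (next l) +_) (+-comm (wraps j i * n) _) ⟩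
    toℕ (next l) + (wrap l * n + wraps j i * n)    ≡⟨ +-assoc (toℕ (next l)) _ _ ⟨
    toℕ (next l) + wrap l * n + wraps j i * n      ≡⟨ cong (_+ wraps j i * n) (toℕ-next l) ⟩
    suc (toℕ l + wraps j i * n)                    ≡⟨ cong suc (level-wraps j i) ⟩
    suc (toℕ i + j)                                ≡⟨ +-suc (toℕ i) j ⟨
    toℕ i + suc j                                  ∎
    where l = iter next j i

  displacement-wraps : ∀ d j i →
    displacement d j i + prefixSum d (toℕ i) ≡ prefixSum d (toℕ (iter next j i)) + wraps j i * prefixSum d n
  displacement-wraps d zero    i = sym (+-identityʳ _)
  displacement-wraps d (suc j) i = begin
    D j + d (toℕ l) + S (toℕ i)            ≡⟨ +-assoc (D j) _ _ ⟩
    D j + (d (toℕ l) + S (toℕ i))          ≡⟨ cong (D j +_) (+-comm (d (toℕ l)) _) ⟩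
    D j + (S (toℕ i) + d (toℕ l))          ≡⟨ +-assoc (D j) _ _ ⟨
    D j + S (toℕ i) + d (toℕ l)            ≡⟨ cong (_+ d (toℕ l)) (displacement-wraps d j i) ⟩
    S (toℕ l) + w * T + d (toℕ l)          ≡⟨ +-assoc (S (toℕ l)) _ _ ⟩
    S (toℕ l) + (w * T + d (toℕ l))        ≡⟨ cong (S (toℕ l) +_) (+-comm (w * T) _) ⟩
    S (toℕ l) + (d (toℕ l) + w * T)        ≡⟨ +-assoc (S (toℕ l)) _ _ ⟨
    S (suc (toℕ l)) + w * T                ≡⟨ cong (_+ w * T) (prefixSum-next d l) ⟩
    S (toℕ (next l)) + wrap l * T + w * T  ≡⟨ +-assoc (S (toℕ (next l))) _ _ ⟩
    S (toℕ (next l)) + (wrap l * T + w * T) ≡⟨ cong (S (toℕ (next l)) +_) (*-distribʳ-+ T (wrap l) w) ⟨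
    S (toℕ (next l)) + (wrap l + w) * T    ≡⟨ cong (λ z → S (toℕ (next l)) + z * T) (+-comm (wrap l) w) ⟩
    S (toℕ (next l)) + (w + wrap l) * T    ∎
    where
    l = iter next j i
    w = wraps j i
    S = prefixSum d
    D = λ j → displacement d j i
    T = prefixSum d n

  returns : ∀ j i → iter next j i ≡ i → j ≡ wraps j i * n × (∀ d → displacement d j i ≡ wraps j i * prefixSum d n)
  returns j i back = j≡ , disp≡
    where
    j≡ : j ≡ wraps j i * n
    j≡ = +-cancelˡ-≡ (toℕ i) _ _ (trans (sym (level-wraps j i)) (cong (λ l → toℕ l + wraps j i * n) back))
    disp≡ : ∀ d → displacement d j i ≡ wraps j i * prefixSum d n
    disp≡ d = +-cancelʳ-≡ (prefixSum d (toℕ i)) _ _ (begin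
      displacement d j i + prefixSum d (toℕ i)                              ≡⟨ displacement-wraps d j i ⟩
      prefixSum d (toℕ (iter next j i)) + wraps j i * prefixSum d n         ≡⟨ cong (λ l → prefixSum d (toℕ l) + wraps j i * prefixSum d n) back ⟩
      prefixSum d (toℕ i) + wraps j i * prefixSum d n                       ≡⟨ +-comm (prefixSum d (toℕ i)) _ ⟩
      wraps j i * prefixSum d n + prefixSum d (toℕ i)                       ∎)

  rounds-return : ∀ c i → iter next (c * n) i ≡ i × wraps (c * n) i ≡ c
  rounds-return c i = toℕ-injective (proj₁ unique) , proj₂ unique
    where
    unique = remainder-unique n (toℕ<n (iter next (c * n) i)) (toℕ<n i) (level-wraps (c * n) i)

  uniformCycles : ∀ c
    → (∀ g → act (c * prefixSum d₁ n) (c * prefixSum d₂ n) g ≡ g)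
    → (∀ w → 0 < w → w < c → ∀ g → act (w * prefixSum d₁ n) (w * prefixSum d₂ n) g ≢ g)
    → UniformCycles step (c * n)
  uniformCycles c rounds-close shorter-moves = closed , no-early-return
    where
    closed : ∀ u → iter step (c * n) u ≡ u
    closed (g , i) = begin
      iter step (c * n) (g , i)     ≡⟨ iter-step (c * n) g i ⟩
      (act (displacement d₁ (c * n) i) (displacement d₂ (c * n) i) g , iter next (c * n) i)
        ≡⟨ cong₂ _,_ (trans (cong₂ (λ a b → act a b g) (round d₁) (round d₂)) (rounds-close g)) back ⟩
      (g , i)                       ∎
      where
      back = proj₁ (rounds-return c i)
      round : ∀ d → displacement d (c * n) i ≡ c * prefixSum d n
      round d = trans (proj₂ (returns (c * n) i back) d) (cong (_* prefixSum d n) (proj₂ (rounds-return c i)))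
    no-early-return : ∀ u j → 0 < j → j < c * n → iter step j u ≢ u
    no-early-return (g , i) j 0<j j<cn fixed = shorter-moves w 0<w w<c g g-fixed
      where
      fixed′ = trans (sym (iter-step j g i)) fixed
      back = cong proj₂ fixed′
      w = wraps j i
      j≡ = proj₁ (returns j i back)
      g-fixed : act (w * prefixSum d₁ n) (w * prefixSum d₂ n) g ≡ g
      g-fixed = trans (cong₂ (λ a b → act a b g) (sym (disp≡ d₁)) (sym (disp≡ d₂))) (cong proj₁ fixed′)
        where disp≡ = proj₂ (returns j i back)
      0<w : 0 < w
      0<w = n≢0⇒n>0 (λ w≡0 → <-irrefl (sym (trans j≡ (cong (_* n) w≡0))) 0<j)
      w<c : w < c
      w<c = *-cancelʳ-< n w c (subst (_< c * n) j≡ j<cn)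

-- Permutations with short moves

ShortMove : ℕ → ℕ → Set
ShortMove j k = (k + 1 ≡ j) ⊎ (j + 1 ≡ k) ⊎ (k + 2 ≡ j)

ShortMove-+ : ∀ c {j k} → ShortMove j k → ShortMove (c + j) (c + k)
ShortMove-+ c {j} {k} (inj₁ e)        = inj₁ (trans (+-assoc c k 1) (cong (c +_) e))
ShortMove-+ c {j} {k} (inj₂ (inj₁ e)) = inj₂ (inj₁ (trans (+-assoc c j 1) (cong (c +_) e)))
ShortMove-+ c {j} {k} (inj₂ (inj₂ e)) = inj₂ (inj₂ (trans (+-assoc c k 2) (cong (c +_) e)))

-- For L ≥ 2 a fixed-point-free permutation of {0, …, L − 1} moving every point by
-- ±1 or −2: the transpositions (0 1)(2 3)…, ending for odd L with the 3-cycle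
-- L−3 ↦ L−2 ↦ L−1 ↦ L−3.  Values outside {0, …, L − 1} are junk.
shortPerm shortPerm⁻¹ : ℕ → ℕ → ℕ
shortPerm 2 0 = 1
shortPerm 2 1 = 0
shortPerm 3 0 = 1
shortPerm 3 1 = 2
shortPerm 3 2 = 0
shortPerm (suc (suc (suc (suc L)))) 0 = 1
shortPerm (suc (suc (suc (suc L)))) 1 = 0
shortPerm (suc (suc (suc (suc L)))) (suc (suc j)) = 2 + shortPerm (suc (suc L)) j
shortPerm _ j = j

shortPerm⁻¹ 2 0 = 1
shortPerm⁻¹ 2 1 = 0
shortPerm⁻¹ 3 0 = 2
shortPerm⁻¹ 3 1 = 0
shortPerm⁻¹ 3 2 = 1
shortPerm⁻¹ (suc (suc (suc (suc L)))) 0 = 1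
shortPerm⁻¹ (suc (suc (suc (suc L)))) 1 = 0
shortPerm⁻¹ (suc (suc (suc (suc L)))) (suc (suc j)) = 2 + shortPerm⁻¹ (suc (suc L)) j
shortPerm⁻¹ _ j = j

RangePreserving : (ℕ → ℕ → ℕ) → Set
RangePreserving f = ∀ L j → j < L → f L j < L

shortPerm-< : RangePreserving shortPerm
shortPerm-< 1 0 _ = z<s
shortPerm-< 2 0 _ = s<s z<s
shortPerm-< 2 1 _ = z<s
shortPerm-< 3 0 _ = s<s z<s
shortPerm-< 3 1 _ = s<s (s<s z<s)
shortPerm-< 3 2 _ = z<s
shortPerm-< (suc (suc (suc (suc L)))) 0 _ = s<s z<s
shortPerm-< (suc (suc (suc (suc L)))) 1 _ = z<s
shortPerm-< (suc (suc (suc (suc L)))) (suc (suc j)) (s<s (s<s j<)) = s<s (s<s (shortPerm-< (suc (suc L)) j j<))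
shortPerm-< 1 (suc j) (s<s ())
shortPerm-< 2 (suc (suc j)) (s<s (s<s ()))
shortPerm-< 3 (suc (suc (suc j))) (s<s (s<s (s<s ())))

shortPerm⁻¹-< : RangePreserving shortPerm⁻¹
shortPerm⁻¹-< 1 0 _ = z<s
shortPerm⁻¹-< 2 0 _ = s<s z<s
shortPerm⁻¹-< 2 1 _ = z<s
shortPerm⁻¹-< 3 0 _ = s<s (s<s z<s)
shortPerm⁻¹-< 3 1 _ = z<s
shortPerm⁻¹-< 3 2 _ = s<s z<s
shortPerm⁻¹-< (suc (suc (suc (suc L)))) 0 _ = s<s z<s
shortPerm⁻¹-< (suc (suc (suc (suc L)))) 1 _ = z<s
shortPerm⁻¹-< (suc (suc (suc (suc L)))) (suc (suc j)) (s<s (s<s j<)) = s<s (s<s (shortPerm⁻¹-< (suc (suc L)) j j<))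
shortPerm⁻¹-< 1 (suc j) (s<s ())
shortPerm⁻¹-< 2 (suc (suc j)) (s<s (s<s ()))
shortPerm⁻¹-< 3 (suc (suc (suc j))) (s<s (s<s (s<s ())))

shortPerm⁻¹-shortPerm : ∀ L j → j < L → shortPerm⁻¹ L (shortPerm L j) ≡ j
shortPerm⁻¹-shortPerm 1 0 _ = refl
shortPerm⁻¹-shortPerm 2 0 _ = refl
shortPerm⁻¹-shortPerm 2 1 _ = refl
shortPerm⁻¹-shortPerm 3 0 _ = refl
shortPerm⁻¹-shortPerm 3 1 _ = refl
shortPerm⁻¹-shortPerm 3 2 _ = refl
shortPerm⁻¹-shortPerm (suc (suc (suc (suc L)))) 0 _ = refl
shortPerm⁻¹-shortPerm (suc (suc (suc (suc L)))) 1 _ = refl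
shortPerm⁻¹-shortPerm (suc (suc (suc (suc L)))) (suc (suc j)) (s<s (s<s j<)) =
  cong (2 +_) (shortPerm⁻¹-shortPerm (suc (suc L)) j j<)
shortPerm⁻¹-shortPerm 1 (suc j) (s<s ())
shortPerm⁻¹-shortPerm 2 (suc (suc j)) (s<s (s<s ()))
shortPerm⁻¹-shortPerm 3 (suc (suc (suc j))) (s<s (s<s (s<s ())))

shortPerm-shortPerm⁻¹ : ∀ L j → j < L → shortPerm L (shortPerm⁻¹ L j) ≡ j
shortPerm-shortPerm⁻¹ 1 0 _ = refl
shortPerm-shortPerm⁻¹ 2 0 _ = refl
shortPerm-shortPerm⁻¹ 2 1 _ = refl
shortPerm-shortPerm⁻¹ 3 0 _ = refl
shortPerm-shortPerm⁻¹ 3 1 _ = refl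
shortPerm-shortPerm⁻¹ 3 2 _ = refl
shortPerm-shortPerm⁻¹ (suc (suc (suc (suc L)))) 0 _ = refl
shortPerm-shortPerm⁻¹ (suc (suc (suc (suc L)))) 1 _ = refl
shortPerm-shortPerm⁻¹ (suc (suc (suc (suc L)))) (suc (suc j)) (s<s (s<s j<)) =
  cong (2 +_) (shortPerm-shortPerm⁻¹ (suc (suc L)) j j<)
shortPerm-shortPerm⁻¹ 1 (suc j) (s<s ())
shortPerm-shortPerm⁻¹ 2 (suc (suc j)) (s<s (s<s ()))
shortPerm-shortPerm⁻¹ 3 (suc (suc (suc j))) (s<s (s<s (s<s ())))

shortPerm-shortMove : ∀ L j → 2 ≤ L → j < L → ShortMove j (shortPerm L j)
shortPerm-shortMove 2 0 _ _ = inj₂ (inj₁ refl)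
shortPerm-shortMove 2 1 _ _ = inj₁ refl
shortPerm-shortMove 3 0 _ _ = inj₂ (inj₁ refl)
shortPerm-shortMove 3 1 _ _ = inj₂ (inj₁ refl)
shortPerm-shortMove 3 2 _ _ = inj₂ (inj₂ refl)
shortPerm-shortMove (suc (suc (suc (suc L)))) 0 _ _ = inj₂ (inj₁ refl)
shortPerm-shortMove (suc (suc (suc (suc L)))) 1 _ _ = inj₁ refl
shortPerm-shortMove (suc (suc (suc (suc L)))) (suc (suc j)) _ (s<s (s<s j<)) =
  ShortMove-+ 2 (shortPerm-shortMove (suc (suc L)) j (s≤s (s≤s z≤n)) j<)
shortPerm-shortMove 1 _ (s≤s ()) _
shortPerm-shortMove 2 (suc (suc j)) _ (s<s (s<s ()))
shortPerm-shortMove 3 (suc (suc (suc j))) _ (s<s (s<s (s<s ())))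

-- The displacement used at each level, as a function of a coordinate z of the
-- factor's cell and the same coordinate ρz of its image under the cell permutation.
data Kind : Set where
  twice minus plus minusρ : Kind

shift : Kind → (M z ρz : ℕ) → ℕ
shift twice  M z ρz = 2 * z
shift minus  M z ρz = M ∸ z
shift plus   M z ρz = z
shift minusρ M z ρz = M ∸ ρz

levels : ℕ → ℕ
levels k = suc (suc (suc (k + k)))

-- Over the 2k + 3 levels: twice, then k times (minus, plus), then minus, minusρ.
tailKind : ℕ → ℕ → Kind
tailKind zero    zero          = minus
tailKind zero    (suc zero)    = minusρ
tailKind zero    (suc (suc l)) = plus
tailKind (suc k) zero          = minus
tailKind (suc k) (suc zero)    = plus
tailKind (suc k) (suc (suc l)) = tailKind k l

levelKind : ℕ → ℕ → Kind
levelKind k zero    = twice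
levelKind k (suc l) = tailKind k l

prefixSum-suc : ∀ d L → prefixSum d (suc L) ≡ d 0 + prefixSum (d ∘ suc) L
prefixSum-suc d zero    = +-comm 0 (d 0)
prefixSum-suc d (suc L) = trans (cong (_+ d (suc L)) (prefixSum-suc d L)) (+-assoc (d 0) _ _)

module _ (M z ρz : ℕ) (z≤M : z ≤ M) (ρz≤M : ρz ≤ M) where

  tailSum : ∀ k → prefixSum (λ l → shift (tailKind k l) M z ρz) (suc (suc (k + k))) + ρz + z ≡ (2 + k) * M
  tailSum zero = begin
    (M ∸ z) + (M ∸ ρz) + ρz + z   ≡⟨ cong (_+ z) (+-assoc (M ∸ z) (M ∸ ρz) ρz) ⟩
    (M ∸ z) + ((M ∸ ρz) + ρz) + z ≡⟨ cong (λ q → (M ∸ z) + q + z) (m∸n+n≡m ρz≤M) ⟩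
    (M ∸ z) + M + z               ≡⟨ +-assoc (M ∸ z) M z ⟩
    (M ∸ z) + (M + z)             ≡⟨ cong ((M ∸ z) +_) (+-comm M z) ⟩
    (M ∸ z) + (z + M)             ≡⟨ +-assoc (M ∸ z) z M ⟨
    (M ∸ z) + z + M               ≡⟨ cong (_+ M) (m∸n+n≡m z≤M) ⟩
    M + M                         ≡⟨ cong (M +_) (+-identityʳ M) ⟨
    2 * M                         ∎
  tailSum (suc k) = begin
    prefixSum d (suc (suc (suc k + suc k))) + ρz + z
      ≡⟨ cong (λ q → q + ρz + z) (prefixSum-suc d (suc (suc k + suc k))) ⟩
    (M ∸ z) + prefixSum (d ∘ suc) (suc (suc k + suc k)) + ρz + z
      ≡⟨ cong (λ q → (M ∸ z) + q + ρz + z) (prefixSum-suc (d ∘ suc) (suc k + suc k)) ⟩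
    (M ∸ z) + (z + prefixSum d′ (suc (k + suc k))) + ρz + z
      ≡⟨ cong (λ q → (M ∸ z) + (z + prefixSum d′ (suc q)) + ρz + z) (+-suc k k) ⟩
    (M ∸ z) + (z + R) + ρz + z    ≡⟨ cong (λ q → q + ρz + z) (+-assoc (M ∸ z) z R) ⟨
    (M ∸ z) + z + R + ρz + z      ≡⟨ cong (λ q → q + R + ρz + z) (m∸n+n≡m z≤M) ⟩
    M + R + ρz + z                ≡⟨ cong (_+ z) (+-assoc M R ρz) ⟩
    M + (R + ρz) + z              ≡⟨ +-assoc M (R + ρz) z ⟩
    M + (R + ρz + z)              ≡⟨ cong (M +_) (tailSum k) ⟩
    M + (2 + k) * M               ∎
    where
    d = λ l → shift (tailKind (suc k) l) M z ρz
    d′ = λ l → shift (tailKind k l) M z ρz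
    R = prefixSum d′ (suc (suc (k + k)))

  roundSum : ∀ k → prefixSum (λ l → shift (levelKind k l) M z ρz) (levels k) + ρz ≡ z + (2 + k) * M
  roundSum k = begin
    prefixSum (λ l → shift (levelKind k l) M z ρz) (levels k) + ρz ≡⟨ cong (_+ ρz) (prefixSum-suc _ (suc (suc (k + k)))) ⟩
    2 * z + R + ρz       ≡⟨ cong (λ q → q + R + ρz) (cong (z +_) (+-identityʳ z)) ⟩
    z + z + R + ρz       ≡⟨ cong (_+ ρz) (+-assoc z z R) ⟩
    z + (z + R) + ρz     ≡⟨ +-assoc z (z + R) ρz ⟩
    z + (z + R + ρz)     ≡⟨ cong (z +_) (trans (+-assoc z R ρz) (+-comm z (R + ρz))) ⟩
    z + (R + ρz + z)     ≡⟨ cong (z +_) (tailSum k) ⟩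
    z + (2 + k) * M      ∎
    where
    R = prefixSum (λ l → shift (tailKind k l) M z ρz) (suc (suc (k + k)))

odd∣2*⇒∣ : ∀ h w → suc (2 * h) ∣ 2 * w → suc (2 * h) ∣ w
odd∣2*⇒∣ h w M∣2w = ∣m+n∣m⇒∣n M∣wM+w (n∣m*n w)
  where
  M∣wM+w : suc (2 * h) ∣ w * suc (2 * h) + w
  M∣wM+w = subst (suc (2 * h) ∣_) (trans ([1+h]*[2*z]≡z+z*[1+2h] h w) (+-comm w _)) (∣n⇒∣m*n (suc h) M∣2w)

-- Since z − ρz ∈ {1, −1, 2} is a unit modulo the odd number M, so is the round sum T.
shortMove-unit : ∀ h {w T z ρz K} → 0 < w → w < suc (2 * h) → ShortMove z ρz →
  T + ρz ≡ z + K * suc (2 * h) → suc (2 * h) ∤ w * T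
shortMove-unit h {w} {T} {z} {ρz} {K} 0<w w<M move round M∣wT =
  <⇒≱ w<M (∣⇒≤ {{>-nonZero 0<w}} (M∣w move))
  where
  M = suc (2 * h)
  M∣wKM : M ∣ w * K * M
  M∣wKM = n∣m*n (w * K)
  T≡δ+KM : ∀ {δ} → ρz + δ ≡ z → T ≡ δ + K * M
  T≡δ+KM {δ} eq = +-cancelˡ-≡ ρz T _ (begin
    ρz + T            ≡⟨ +-comm ρz T ⟩
    T + ρz            ≡⟨ round ⟩
    z + K * M         ≡⟨ cong (_+ K * M) eq ⟨
    ρz + δ + K * M    ≡⟨ +-assoc ρz δ _ ⟩
    ρz + (δ + K * M)  ∎)
  M∣w : ShortMove z ρz → M ∣ w
  M∣w (inj₁ ρz+1≡z) = ∣m+n∣m⇒∣n (subst (M ∣_) wT≡ M∣wT) M∣wKM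
    where
    wT≡ : w * T ≡ w * K * M + w
    wT≡ = trans (cong (w *_) (T≡δ+KM ρz+1≡z)) (identity w K M)
      where
      identity : ∀ w K M → w * (1 + K * M) ≡ w * K * M + w
      identity = solve-∀
  M∣w (inj₂ (inj₁ z+1≡ρz)) = ∣m+n∣m⇒∣n (subst (M ∣_) wKM≡ M∣wKM) M∣wT
    where
    T+1≡KM : T + 1 ≡ K * M
    T+1≡KM = +-cancelˡ-≡ z _ _ (trans (identity z T) (trans (cong (T +_) z+1≡ρz) round))
      where
      identity : ∀ z T → z + (T + 1) ≡ T + (z + 1)
      identity = solve-∀
    wKM≡ : w * K * M ≡ w * T + w
    wKM≡ = trans (*-assoc w K M) (trans (cong (w *_) (sym T+1≡KM)) (identity w T))
      where
      identity : ∀ w T → w * (T + 1) ≡ w * T + w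
      identity = solve-∀
  M∣w (inj₂ (inj₂ ρz+2≡z)) = odd∣2*⇒∣ h w (∣m+n∣m⇒∣n (subst (M ∣_) wT≡ M∣wT) M∣wKM)
    where
    wT≡ : w * T ≡ w * K * M + 2 * w
    wT≡ = trans (cong (w *_) (T≡δ+KM ρz+2≡z)) (identity w K M)
      where
      identity : ∀ w K M → w * (2 + K * M) ≡ w * K * M + 2 * w
      identity = solve-∀

-- Staircase regions and their factors

Cell : ℕ → ℕ → Set
Cell x y = Fin x × Fin y

Under : ∀ {x y} → (Fin y → ℕ) → Cell x y → Set
Under len (a , b) = toℕ a < len b

-- A region A of the x × y grid of cells such that, for fixed b, the cells (a , b)
-- of A are those with a < len₁ b and, for fixed a, those with b < len₂ a.
record Shape (x y s : ℕ) : Set where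
  field
    len₁ : Fin y → ℕ
    len₂ : Fin x → ℕ
    len₁≤x : ∀ b → len₁ b ≤ x
    len₂≤y : ∀ a → len₂ a ≤ y
    <len₁⇒<len₂ : ∀ a b → toℕ a < len₁ b → toℕ b < len₂ a
    <len₂⇒<len₁ : ∀ a b → toℕ b < len₂ a → toℕ a < len₁ b
    len₁≢1 : 1 < x → ∀ b → len₁ b ≢ 1
    y∸len₂≢1 : 1 < y → ∀ a → y ∸ len₂ a ≢ 1
    enum : Fin (y * x) ↔ Cell x y
    enum-< : ∀ κ → toℕ κ < s → Under len₁ (Inverse.to enum κ)
    enum-≥ : ∀ κ → s ≤ toℕ κ → ¬ Under len₁ (Inverse.to enum κ)

record ArcPartition (I : Set) (v k : ℕ) : Set where
  field
    fac     : I → Vtx v k → Vtx v k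
    fac-arc : ∀ t u → Arc v k u (fac t u)
    covers  : ∀ u w → Arc v k u w → ∃ λ t → fac t u ≡ w
    unique  : ∀ u t t′ → fac t u ≡ fac t′ u → t ≡ t′

module CellPermutation {x y s : ℕ} (S : Shape x y s) where

  open Shape S

  len₂≤b : ∀ a b → ¬ toℕ a < len₁ b → len₂ a ≤ toℕ b
  len₂≤b a b a∉ = ≮⇒≥ (λ b< → a∉ (<len₂⇒<len₁ a b b<))

  b∸len₂< : ∀ a (b : Fin y) → ¬ toℕ a < len₁ b → toℕ b ∸ len₂ a < y ∸ len₂ a
  b∸len₂< a b a∉ = ∸-monoˡ-< (toℕ<n b) (len₂≤b a b a∉)

  segment-< : ∀ f → RangePreserving f → ∀ a b → ¬ toℕ a < len₁ b → len₂ a + f (y ∸ len₂ a) (toℕ b ∸ len₂ a) < y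
  segment-< f f-< a b a∉ = subst (len₂ a + f (y ∸ len₂ a) (toℕ b ∸ len₂ a) <_) (m+[n∸m]≡n (len₂≤y a))
    (+-monoʳ-< (len₂ a) (f-< _ _ (b∸len₂< a b a∉)))

  cellPerm : ∀ f → RangePreserving f → Cell x y → Cell x y
  cellPerm f f-< (a , b) with toℕ a <? len₁ b
  ... | yes a∈ = fromℕ< (<-≤-trans (f-< _ _ a∈) (len₁≤x b)) , b
  ... | no a∉  = a , fromℕ< (segment-< f f-< a b a∉)

  cellPerm-A : ∀ f f-< a b → toℕ a < len₁ b →
    toℕ (proj₁ (cellPerm f f-< (a , b))) ≡ f (len₁ b) (toℕ a) × proj₂ (cellPerm f f-< (a , b)) ≡ b
  cellPerm-A f f-< a b a∈ with toℕ a <? len₁ b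
  ... | yes _ = toℕ-fromℕ< _ , refl
  ... | no a∉ = ⊥-elim (a∉ a∈)

  cellPerm-B : ∀ f f-< a b → ¬ toℕ a < len₁ b →
    proj₁ (cellPerm f f-< (a , b)) ≡ a × toℕ (proj₂ (cellPerm f f-< (a , b))) ≡ len₂ a + f (y ∸ len₂ a) (toℕ b ∸ len₂ a)
  cellPerm-B f f-< a b a∉ with toℕ a <? len₁ b
  ... | yes a∈ = ⊥-elim (a∉ a∈)
  ... | no _   = refl , toℕ-fromℕ< _

  cellPerm-inverse : ∀ f f-< g g-< → (∀ L j → j < L → g L (f L j) ≡ j) →
    ∀ t → cellPerm g g-< (cellPerm f f-< t) ≡ t
  cellPerm-inverse f f-< g g-< gf (a , b) with toℕ a <? len₁ b
  ... | yes a∈ = cong₂ _,_ (toℕ-injective (begin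
          toℕ (proj₁ (cellPerm g g-< (a′ , b)))   ≡⟨ proj₁ (cellPerm-A g g-< a′ b a′∈) ⟩
          g (len₁ b) (toℕ a′)                     ≡⟨ cong (g (len₁ b)) (toℕ-fromℕ< _) ⟩
          g (len₁ b) (f (len₁ b) (toℕ a))         ≡⟨ gf _ _ a∈ ⟩
          toℕ a                                   ∎))
        (proj₂ (cellPerm-A g g-< a′ b a′∈))
    where
    a′ = fromℕ< (<-≤-trans (f-< _ _ a∈) (len₁≤x b))
    a′∈ : toℕ a′ < len₁ b
    a′∈ = subst (_< len₁ b) (sym (toℕ-fromℕ< _)) (f-< _ _ a∈)
  ... | no a∉ = cong₂ _,_ (proj₁ (cellPerm-B g g-< a b′ a∉′)) (toℕ-injective (begin
          toℕ (proj₂ (cellPerm g g-< (a , b′)))   ≡⟨ proj₂ (cellPerm-B g g-< a b′ a∉′) ⟩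
          len₂ a + g L (toℕ b′ ∸ len₂ a)          ≡⟨ cong (λ q → len₂ a + g L (q ∸ len₂ a)) (toℕ-fromℕ< _) ⟩
          len₂ a + g L (len₂ a + f L j ∸ len₂ a)  ≡⟨ cong (λ q → len₂ a + g L q) (m+n∸m≡n (len₂ a) (f L j)) ⟩
          len₂ a + g L (f L j)                    ≡⟨ cong (len₂ a +_) (gf L j (b∸len₂< a b a∉)) ⟩
          len₂ a + (toℕ b ∸ len₂ a)               ≡⟨ m+[n∸m]≡n (len₂≤b a b a∉) ⟩
          toℕ b                                   ∎))
    where
    L = y ∸ len₂ a
    j = toℕ b ∸ len₂ a
    b′ = fromℕ< (segment-< f f-< a b a∉)
    a∉′ : ¬ toℕ a < len₁ b′
    a∉′ a∈ = <⇒≱ (<len₁⇒<len₂ a b′ a∈) (subst (len₂ a ≤_) (sym (toℕ-fromℕ< _)) (m≤m+n (len₂ a) _))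

  ρ ρ⁻¹ : Cell x y → Cell x y
  ρ = cellPerm shortPerm shortPerm-<
  ρ⁻¹ = cellPerm shortPerm⁻¹ shortPerm⁻¹-<

  ρ⁻¹-ρ : ∀ t → ρ⁻¹ (ρ t) ≡ t
  ρ⁻¹-ρ = cellPerm-inverse shortPerm shortPerm-< shortPerm⁻¹ shortPerm⁻¹-< shortPerm⁻¹-shortPerm

  ρ-ρ⁻¹ : ∀ t → ρ (ρ⁻¹ t) ≡ t
  ρ-ρ⁻¹ = cellPerm-inverse shortPerm⁻¹ shortPerm⁻¹-< shortPerm shortPerm-< shortPerm-shortPerm⁻¹

-- ℤₓ × ℤ_y acting on the vertex labels Fin (x * y) by translation.
module Translation (x y : ℕ) .{{_ : NonZero x}} .{{_ : NonZero y}} where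

  module X = ZMod x
  module Y = ZMod y

  V : Set
  V = Fin (x * y)

  cell : V → Cell x y
  cell = remQuot {x} y

  act : ℕ → ℕ → V → V
  act e₁ e₂ g = combine {x} {y} (proj₁ (cell g) X.⊕ e₁) (proj₂ (cell g) Y.⊕ e₂)

  cell-act : ∀ e₁ e₂ g → cell (act e₁ e₂ g) ≡ (proj₁ (cell g) X.⊕ e₁ , proj₂ (cell g) Y.⊕ e₂)
  cell-act e₁ e₂ g = remQuot-combine {x} {y} (proj₁ (cell g) X.⊕ e₁) (proj₂ (cell g) Y.⊕ e₂)

  combine-cell : ∀ {a b} g → (a , b) ≡ cell g → combine a b ≡ g
  combine-cell g refl = combine-remQuot {x} y g

  act-zero : ∀ g → act 0 0 g ≡ g
  act-zero g = combine-cell g (cong₂ _,_ (X.⊕-identityʳ (proj₁ (cell g))) (Y.⊕-identityʳ (proj₂ (cell g))))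

  act-+ : ∀ a b a′ b′ g → act a b (act a′ b′ g) ≡ act (a′ + a) (b′ + b) g
  act-+ a b a′ b′ g = begin
    combine (proj₁ (cell (act a′ b′ g)) X.⊕ a) (proj₂ (cell (act a′ b′ g)) Y.⊕ b)
      ≡⟨ cong (λ c → combine (proj₁ c X.⊕ a) (proj₂ c Y.⊕ b)) (cell-act a′ b′ g) ⟩
    combine (proj₁ (cell g) X.⊕ a′ X.⊕ a) (proj₂ (cell g) Y.⊕ b′ Y.⊕ b)
      ≡⟨ cong₂ combine (X.⊕-assoc (proj₁ (cell g)) a′ a) (Y.⊕-assoc (proj₂ (cell g)) b′ b) ⟩
    act (a′ + a) (b′ + b) g ∎

  act-multiples : ∀ p q g → act (p * x) (q * y) g ≡ g
  act-multiples p q g = combine-cell g (cong₂ _,_ (X.⊕-multiple (proj₁ (cell g)) p) (Y.⊕-multiple (proj₂ (cell g)) q))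

  act-fixed₁ : ∀ {e₁ e₂} g → act e₁ e₂ g ≡ g → x ∣ e₁
  act-fixed₁ {e₁} g fixed = X.⊕-fixed⇒∣ (proj₁ (cell g)) e₁ (cong proj₁ (trans (sym (cell-act _ _ g)) (cong cell fixed)))

  act-fixed₂ : ∀ {e₁ e₂} g → act e₁ e₂ g ≡ g → y ∣ e₂
  act-fixed₂ {e₂ = e₂} g fixed = Y.⊕-fixed⇒∣ (proj₂ (cell g)) e₂ (cong proj₂ (trans (sym (cell-act _ _ g)) (cong cell fixed)))

  difference : V → V → Cell x y
  difference g g′ = proj₁ (cell g′) X.⊖ proj₁ (cell g) , proj₂ (cell g′) Y.⊖ proj₂ (cell g)

  act≡⇒difference : ∀ e₁ e₂ g g′ → act e₁ e₂ g ≡ g′ → (e₁ mod x , e₂ mod y) ≡ difference g g′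
  act≡⇒difference e₁ e₂ g g′ eq = cong₂ _,_
    (X.⊕≡⇒mod≡⊖ (proj₁ (cell g)) e₁ (proj₁ (cell g′)) (cong proj₁ lands))
    (Y.⊕≡⇒mod≡⊖ (proj₂ (cell g)) e₂ (proj₂ (cell g′)) (cong proj₂ lands))
    where
    lands = trans (sym (cell-act e₁ e₂ g)) (cong cell eq)

  difference⇒act≡ : ∀ e₁ e₂ g g′ → (e₁ mod x , e₂ mod y) ≡ difference g g′ → act e₁ e₂ g ≡ g′
  difference⇒act≡ e₁ e₂ g g′ eq = combine-cell g′ (cong₂ _,_
    (X.mod≡⊖⇒⊕≡ (proj₁ (cell g)) e₁ (proj₁ (cell g′)) (cong proj₁ eq))
    (Y.mod≡⊖⇒⊕≡ (proj₂ (cell g)) e₂ (proj₂ (cell g′)) (cong proj₂ eq)))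

module ShapeFactors (hx hy k s : ℕ) (S : Shape (suc (2 * hx)) (suc (2 * hy)) s) where

  x y n : ℕ
  x = suc (2 * hx)
  y = suc (2 * hy)
  n = levels k

  open Shape S
  module X = ZModOdd hx
  module Y = ZModOdd hy

  open CellPermutation S
  open Translation x y hiding (module X; module Y)

  d₁ d₂ : Cell x y → ℕ → ℕ
  d₁ t l = shift (levelKind k l) x (toℕ (proj₁ t)) (toℕ (proj₁ (ρ t)))
  d₂ t l = shift (levelKind k l) y (toℕ (proj₂ t)) (toℕ (proj₂ (ρ t)))

  module W (t : Cell x y) = Walk act act-zero act-+ (suc (suc (k + k))) (d₁ t) (d₂ t)

  factor : Cell x y → Vtx (x * y) n → Vtx (x * y) n
  factor t = W.step t

  round₁ : ∀ t → prefixSum (d₁ t) n + toℕ (proj₁ (ρ t)) ≡ toℕ (proj₁ t) + (2 + k) * x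
  round₁ t = roundSum x _ _ (<⇒≤ (toℕ<n _)) (<⇒≤ (toℕ<n _)) k

  round₂ : ∀ t → prefixSum (d₂ t) n + toℕ (proj₂ (ρ t)) ≡ toℕ (proj₂ t) + (2 + k) * y
  round₂ t = roundSum y _ _ (<⇒≤ (toℕ<n _)) (<⇒≤ (toℕ<n _)) k

  fixed-round : ∀ {T z} M → T + z ≡ z + (2 + k) * M → T ≡ (2 + k) * M
  fixed-round {T} {z} M eq = +-cancelʳ-≡ z T _ (trans eq (+-comm z _))

  2≤segment : ∀ {j L} → j < L → L ≢ 1 → 2 ≤ L
  2≤segment j<L L≢1 = ≤∧≢⇒< (<-≤-trans z<s j<L) (L≢1 ∘ sym)

  cyclesA : ∀ t → Under len₁ t → UniformCycles (factor t) (x * n)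
  cyclesA (a , b) a∈ = W.uniformCycles (a , b) x rounds-close no-shorter
    where
    t = (a , b)
    ρt₁≡ = proj₁ (cellPerm-A shortPerm shortPerm-< a b a∈)
    T₂≡ : prefixSum (d₂ t) n ≡ (2 + k) * y
    T₂≡ = fixed-round y (subst (λ c → prefixSum (d₂ t) n + toℕ c ≡ toℕ b + (2 + k) * y)
                               (proj₂ (cellPerm-A shortPerm shortPerm-< a b a∈)) (round₂ t))
    rounds-close : ∀ g → act (x * prefixSum (d₁ t) n) (x * prefixSum (d₂ t) n) g ≡ g
    rounds-close g = subst₂ (λ e₁ e₂ → act e₁ e₂ g ≡ g)
      (*-comm (prefixSum (d₁ t) n) x) (trans (*-assoc x (2 + k) y) (cong (x *_) (sym T₂≡)))
      (act-multiples (prefixSum (d₁ t) n) (x * (2 + k)) g)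
    no-shorter : ∀ w → 0 < w → w < x → ∀ g → act (w * prefixSum (d₁ t) n) (w * prefixSum (d₂ t) n) g ≢ g
    no-shorter w 0<w w<x g fixed = shortMove-unit hx {K = 2 + k} 0<w w<x move (round₁ t) (act-fixed₁ g fixed)
      where
      move : ShortMove (toℕ a) (toℕ (proj₁ (ρ t)))
      move = subst (ShortMove (toℕ a)) (sym ρt₁≡)
        (shortPerm-shortMove _ _ (2≤segment a∈ (len₁≢1 (<-≤-trans (s<s 0<w) w<x) b)) a∈)

  cyclesB : ∀ t → ¬ Under len₁ t → UniformCycles (factor t) (y * n)
  cyclesB (a , b) a∉ = W.uniformCycles (a , b) y rounds-close no-shorter
    where
    t = (a , b)
    ρt₂≡ = proj₂ (cellPerm-B shortPerm shortPerm-< a b a∉)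
    T₁≡ : prefixSum (d₁ t) n ≡ (2 + k) * x
    T₁≡ = fixed-round x (subst (λ c → prefixSum (d₁ t) n + toℕ c ≡ toℕ a + (2 + k) * x)
                               (proj₁ (cellPerm-B shortPerm shortPerm-< a b a∉)) (round₁ t))
    rounds-close : ∀ g → act (y * prefixSum (d₁ t) n) (y * prefixSum (d₂ t) n) g ≡ g
    rounds-close g = subst₂ (λ e₁ e₂ → act e₁ e₂ g ≡ g)
      (trans (*-assoc y (2 + k) x) (cong (y *_) (sym T₁≡))) (*-comm (prefixSum (d₂ t) n) y)
      (act-multiples (y * (2 + k)) (prefixSum (d₂ t) n) g)
    no-shorter : ∀ w → 0 < w → w < y → ∀ g → act (w * prefixSum (d₁ t) n) (w * prefixSum (d₂ t) n) g ≢ g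
    no-shorter w 0<w w<y g fixed = shortMove-unit hy {K = 2 + k} 0<w w<y move (round₂ t) (act-fixed₂ g fixed)
      where
      j = toℕ b ∸ len₂ a
      j< = b∸len₂< a b a∉
      move : ShortMove (toℕ b) (toℕ (proj₂ (ρ t)))
      move = subst₂ ShortMove (m+[n∸m]≡n (len₂≤b a b a∉)) (sym ρt₂≡)
        (ShortMove-+ (len₂ a) (shortPerm-shortMove _ j (2≤segment j< (y∸len₂≢1 (<-≤-trans (s<s 0<w) w<y) a)) j<))

  -- At a fixed level, the displacements of the xy factors run through ℤₓ × ℤ_y exactly once.
  levelMap levelMap⁻¹ : Kind → Cell x y → Cell x y
  levelMap twice  (a , b) = X.double a , Y.double b
  levelMap minus  (a , b) = X.neg a , Y.neg b
  levelMap plus   t       = t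
  levelMap minusρ t       = X.neg (proj₁ (ρ t)) , Y.neg (proj₂ (ρ t))

  levelMap⁻¹ twice  (a , b) = X.halve a , Y.halve b
  levelMap⁻¹ minus  (a , b) = X.neg a , Y.neg b
  levelMap⁻¹ plus   t       = t
  levelMap⁻¹ minusρ (a , b) = ρ⁻¹ (X.neg a , Y.neg b)

  levelMap⁻¹-levelMap : ∀ κ t → levelMap⁻¹ κ (levelMap κ t) ≡ t
  levelMap⁻¹-levelMap twice  t = cong₂ _,_ (X.halve-double _) (Y.halve-double _)
  levelMap⁻¹-levelMap minus  t = cong₂ _,_ (X.neg-involutive _) (Y.neg-involutive _)
  levelMap⁻¹-levelMap plus   t = refl
  levelMap⁻¹-levelMap minusρ t = trans (cong ρ⁻¹ (cong₂ _,_ (X.neg-involutive _) (Y.neg-involutive _))) (ρ⁻¹-ρ t)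

  levelMap-levelMap⁻¹ : ∀ κ t → levelMap κ (levelMap⁻¹ κ t) ≡ t
  levelMap-levelMap⁻¹ twice  t = cong₂ _,_ (X.double-halve _) (Y.double-halve _)
  levelMap-levelMap⁻¹ minus  t = cong₂ _,_ (X.neg-involutive _) (Y.neg-involutive _)
  levelMap-levelMap⁻¹ plus   t = refl
  levelMap-levelMap⁻¹ minusρ t =
    trans (cong (λ c → X.neg (proj₁ c) , Y.neg (proj₂ c)) (ρ-ρ⁻¹ _)) (cong₂ _,_ (X.neg-involutive _) (Y.neg-involutive _))

  displacement-mod : ∀ t l → (d₁ t l mod x , d₂ t l mod y) ≡ levelMap (levelKind k l) t
  displacement-mod t l with levelKind k l
  ... | twice  = refl
  ... | minus  = refl
  ... | plus   = cong₂ _,_ (X.mod-toℕ _) (Y.mod-toℕ _)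
  ... | minusρ = refl

  partition : ArcPartition (Cell x y) (x * y) n
  partition = record
    { fac    = factor
    ; fac-arc = λ t u → isNext-next (proj₂ u)
    ; covers = covers
    ; unique = unique
    }
    where
    covers : ∀ u w → Arc (x * y) n u w → ∃ λ t → factor t u ≡ w
    covers (g , l) (g′ , l′) l→l′ = t , cong₂ _,_ (difference⇒act≡ _ _ g g′ hits) (sym (isNext⇒≡next l l′ l→l′))
      where
      κ = levelKind k (toℕ l)
      t = levelMap⁻¹ κ (difference g g′)
      hits = trans (displacement-mod t (toℕ l)) (levelMap-levelMap⁻¹ κ _)
    unique : ∀ u t t′ → factor t u ≡ factor t′ u → t ≡ t′
    unique (g , l) t t′ eq = begin
      t                                ≡⟨ levelMap⁻¹-levelMap κ t ⟨
      levelMap⁻¹ κ (levelMap κ t)      ≡⟨ cong (levelMap⁻¹ κ) (trans (hits t refl) (sym (hits t′ (sym (cong proj₁ eq))))) ⟩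
      levelMap⁻¹ κ (levelMap κ t′)     ≡⟨ levelMap⁻¹-levelMap κ t′ ⟩
      t′                               ∎
      where
      κ = levelKind k (toℕ l)
      g′ = proj₁ (factor t (g , l))
      hits : ∀ t″ → proj₁ (factor t″ (g , l)) ≡ g′ → levelMap κ t″ ≡ difference g g′
      hits t″ eq″ = trans (sym (displacement-mod t″ (toℕ l))) (act≡⇒difference _ _ g g′ eq″)

module _ {I : Set} {v k s ℓ₁ r ℓ₂ : ℕ} (P : ArcPartition I v k) (e : (Fin s ⊎ Fin r) ↔ I) where
  open ArcPartition P
  open Inverse e using (to; from; strictlyInverseˡ; strictlyInverseʳ)

  decomposition : (∀ i → UniformCycles (fac (to (inj₁ i))) ℓ₁)
                → (∀ j → UniformCycles (fac (to (inj₂ j))) ℓ₂)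
                → Decomposition v k s ℓ₁ r ℓ₂
  decomposition cycles₁ cycles₂ = record
    { F₁     = F₁
    ; F₂     = F₂
    ; covers = λ u w u→w → let (t , hit) = covers u w u→w in
        from t , trans (factorNxt≡ (from t) u) (trans (cong (λ t′ → fac t′ u) (strictlyInverseˡ t)) hit)
    ; unique = λ u w τ τ′ hit hit′ → begin
        τ             ≡⟨ strictlyInverseʳ τ ⟨
        from (to τ)   ≡⟨ cong from (unique u (to τ) (to τ′) (trans (sym (factorNxt≡ τ u)) (trans hit (trans (sym hit′) (factorNxt≡ τ′ u))))) ⟩
        from (to τ′)  ≡⟨ strictlyInverseʳ τ′ ⟩
        τ′            ∎
    }
    where
    F₁ : Fin s → CycleFactor v k ℓ₁
    F₁ i = record { nxt = fac (to (inj₁ i)) ; isArc = fac-arc _ ; closes = proj₁ (cycles₁ i) ; minimal = proj₂ (cycles₁ i) }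
    F₂ : Fin r → CycleFactor v k ℓ₂
    F₂ j = record { nxt = fac (to (inj₂ j)) ; isArc = fac-arc _ ; closes = proj₁ (cycles₂ j) ; minimal = proj₂ (cycles₂ j) }
    factorNxt≡ : ∀ τ u → factorNxt F₁ F₂ τ u ≡ fac (to τ) u
    factorNxt≡ (inj₁ i) u = refl
    factorNxt≡ (inj₂ j) u = refl

Decomposition-swap : ∀ {v k s ℓ₁ r ℓ₂} → Decomposition v k s ℓ₁ r ℓ₂ → Decomposition v k r ℓ₂ s ℓ₁
Decomposition-swap D = record
  { F₁     = F₂
  ; F₂     = F₁
  ; covers = λ u w u→w → let (τ , hit) = covers u w u→w in swap τ , trans (swapped-nxt τ u) hit
  ; unique = λ u w τ τ′ hit hit′ → trans (sym (swap-involutive τ)) (trans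
               (cong swap (unique u w (swap τ) (swap τ′) (trans (sym (nxt-swapped τ u)) hit) (trans (sym (nxt-swapped τ′ u)) hit′)))
               (swap-involutive τ′))
  }
  where
  open Decomposition D
  swapped-nxt : ∀ τ u → factorNxt F₂ F₁ (swap τ) u ≡ factorNxt F₁ F₂ τ u
  swapped-nxt (inj₁ i) u = refl
  swapped-nxt (inj₂ j) u = refl
  nxt-swapped : ∀ τ u → factorNxt F₂ F₁ τ u ≡ factorNxt F₁ F₂ (swap τ) u
  nxt-swapped (inj₁ j) u = refl
  nxt-swapped (inj₂ i) u = refl

module _ {s r N : ℕ} (s+r≡N : s + r ≡ N) where

  threshold : (Fin s ⊎ Fin r) ↔ Fin N
  threshold = mk↔ₛ′ (cast s+r≡N ∘ join s r) (splitAt s ∘ cast (sym s+r≡N))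
    (λ κ → toℕ-injective (trans (toℕ-cast s+r≡N _) (trans (cong toℕ (join-splitAt s r _)) (toℕ-cast (sym s+r≡N) κ))))
    (λ τ → trans (cong (splitAt s) (toℕ-injective (trans (toℕ-cast (sym s+r≡N) _) (toℕ-cast s+r≡N _)))) (splitAt-join s r τ))

  threshold-inj₁ : ∀ i → toℕ (Inverse.to threshold (inj₁ i)) < s
  threshold-inj₁ i = subst (_< s) (sym (trans (toℕ-cast s+r≡N _) (toℕ-↑ˡ i r))) (toℕ<n i)

  threshold-inj₂ : ∀ j → s ≤ toℕ (Inverse.to threshold (inj₂ j))
  threshold-inj₂ j = subst (s ≤_) (sym (trans (toℕ-cast s+r≡N _) (toℕ-↑ʳ s j))) (m≤m+n s (toℕ j))

shapeDecomposition : ∀ hx hy k s → Shape (suc (2 * hx)) (suc (2 * hy)) s → s ≤ suc (2 * hx) * suc (2 * hy) →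
  let x = suc (2 * hx) ; y = suc (2 * hy) in
  Decomposition (x * y) (levels k) s (x * levels k) (x * y ∸ s) (y * levels k)
shapeDecomposition hx hy k s S s≤xy = decomposition partition cells
  (λ i → cyclesA (Inverse.to cells (inj₁ i)) (enum-< _ (threshold-inj₁ s+r≡yx i)))
  (λ j → cyclesB (Inverse.to cells (inj₂ j)) (enum-≥ _ (threshold-inj₂ s+r≡yx j)))
  where
  open ShapeFactors hx hy k s S
  open Shape S
  s+r≡yx : s + (x * y ∸ s) ≡ y * x
  s+r≡yx = trans (m+[n∸m]≡n s≤xy) (*-comm x y)
  cells : (Fin s ⊎ Fin (x * y ∸ s)) ↔ Cell x y
  cells = enum ↔-∘ threshold s+r≡yx

Decomposition-transpose : ∀ {x y n s} → s ≤ x * y →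
  Decomposition (y * x) n (x * y ∸ s) (y * n) (y * x ∸ (x * y ∸ s)) (x * n) →
  Decomposition (x * y) n s (x * n) (x * y ∸ s) (y * n)
Decomposition-transpose {x} {y} {n} {s} s≤xy D =
  subst₂ (λ v s′ → Decomposition v n s′ (x * n) (x * y ∸ s) (y * n)) (*-comm y x) yx∸r≡s (Decomposition-swap D)
  where
  yx∸r≡s : y * x ∸ (x * y ∸ s) ≡ s
  yx∸r≡s = trans (cong (_∸ (x * y ∸ s)) (*-comm y x)) (m∸[m∸n]≡n s≤xy)

-- Constructing staircase regions

rowMajor : ∀ x y → Fin (y * x) ↔ Cell x y
rowMajor x y = ×-comm (Fin y) (Fin x) ↔-∘ *↔×

toℕ-rowMajor : ∀ x y (κ : Fin (y * x)) → let (a , b) = Inverse.to (rowMajor x y) κ in toℕ κ ≡ x * toℕ b + toℕ a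
toℕ-rowMajor x y κ = trans (sym (cong toℕ (combine-remQuot {y} x κ))) (toℕ-combine (proj₁ ba) (proj₂ ba))
  where ba = remQuot {y} x κ

-- The cell (A , B) is among the first x * m + c cells in row-major order.
RowMajorPrefix : (m c A B : ℕ) → Set
RowMajorPrefix m c A B = B < m ⊎ (B ≡ m × A < c)

module _ {x m c A B : ℕ} (A<x : A < x) where

  x*i+x≤x*j : ∀ {i j} → i < j → x * i + x ≤ x * j
  x*i+x≤x*j {i} i<j = ≤-trans (≤-reflexive (trans (+-comm (x * i) x) (sym (*-suc x i)))) (*-monoʳ-≤ x i<j)

  <⇒rowMajorPrefix : c < x → x * B + A < x * m + c → RowMajorPrefix m c A B
  <⇒rowMajorPrefix c<x lt with <-cmp B m
  ... | tri< B<m _ _ = inj₁ B<m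
  ... | tri≈ _ refl _ = inj₂ (refl , +-cancelˡ-< (x * B) A c lt)
  ... | tri> _ _ B>m = ⊥-elim (<-asym lt (<-≤-trans (+-monoʳ-< (x * m) c<x) (≤-trans (x*i+x≤x*j B>m) (m≤m+n (x * B) A))))

  rowMajorPrefix⇒< : RowMajorPrefix m c A B → x * B + A < x * m + c
  rowMajorPrefix⇒< (inj₁ B<m) = <-≤-trans (+-monoʳ-< (x * B) A<x) (≤-trans (x*i+x≤x*j B<m) (m≤m+n (x * m) c))
  rowMajorPrefix⇒< (inj₂ (refl , A<c)) = +-monoʳ-< (x * B) A<c

module RowMajorShape (x y m c : ℕ) (c<x : c < x) (c≢1 : 1 < x → c ≢ 1) (m≤y : m ≤ y) (m<y : 0 < c → m < y)
  (y∸m≢1 : 1 < y → y ∸ m ≢ 1) (y∸m+1≢1 : 1 < y → 0 < c → y ∸ suc m ≢ 1) where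

  rowLength : ℕ → ℕ → ℕ
  rowLength zero    zero    = c
  rowLength zero    (suc B) = 0
  rowLength (suc m) zero    = x
  rowLength (suc m) (suc B) = rowLength m B

  <rowLength⇒prefix : ∀ m A B → A < rowLength m B → RowMajorPrefix m c A B
  <rowLength⇒prefix zero    A zero    A<c = inj₂ (refl , A<c)
  <rowLength⇒prefix (suc m) A zero    _   = inj₁ z<s
  <rowLength⇒prefix (suc m) A (suc B) A<  with <rowLength⇒prefix m A B A<
  ... | inj₁ B<m       = inj₁ (s<s B<m)
  ... | inj₂ (B≡m , q) = inj₂ (cong suc B≡m , q)

  prefix⇒<rowLength : ∀ m A B → A < x → RowMajorPrefix m c A B → A < rowLength m B
  prefix⇒<rowLength zero    A zero    _   (inj₂ (_ , A<c))   = A<c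
  prefix⇒<rowLength zero    A (suc B) _   (inj₂ (() , _))
  prefix⇒<rowLength (suc m) A zero    A<x _                  = A<x
  prefix⇒<rowLength (suc m) A (suc B) A<x (inj₁ (s<s B<m))   = prefix⇒<rowLength m A B A<x (inj₁ B<m)
  prefix⇒<rowLength (suc m) A (suc B) A<x (inj₂ (B≡m , A<c)) = prefix⇒<rowLength m A B A<x (inj₂ (suc-injective B≡m , A<c))

  rowLength-values : ∀ m B → rowLength m B ≡ x ⊎ rowLength m B ≡ c ⊎ rowLength m B ≡ 0
  rowLength-values zero    zero    = inj₂ (inj₁ refl)
  rowLength-values zero    (suc B) = inj₂ (inj₂ refl)
  rowLength-values (suc m) zero    = inj₁ refl
  rowLength-values (suc m) (suc B) = rowLength-values m B

  columnLength : ℕ → ℕ → ℕ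
  columnLength zero    A       = m
  columnLength (suc c) zero    = suc m
  columnLength (suc c) (suc A) = columnLength c A

  <columnLength⇒prefix : ∀ c A B → B < columnLength c A → RowMajorPrefix m c A B
  <columnLength⇒prefix zero    A       B B<m = inj₁ B<m
  <columnLength⇒prefix (suc c) zero    B B<  with m≤n⇒m<n∨m≡n (s≤s⁻¹ B<)
  ... | inj₁ B<m = inj₁ B<m
  ... | inj₂ B≡m = inj₂ (B≡m , z<s)
  <columnLength⇒prefix (suc c) (suc A) B B<  with <columnLength⇒prefix c A B B<
  ... | inj₁ B<m         = inj₁ B<m
  ... | inj₂ (B≡m , A<c) = inj₂ (B≡m , s<s A<c)

  prefix⇒<columnLength : ∀ c A B → RowMajorPrefix m c A B → B < columnLength c A
  prefix⇒<columnLength zero    A       B (inj₁ B<m)               = B<m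
  prefix⇒<columnLength (suc c) zero    B (inj₁ B<m)               = m<n⇒m<1+n B<m
  prefix⇒<columnLength (suc c) zero    B (inj₂ (refl , _))        = n<1+n m
  prefix⇒<columnLength (suc c) (suc A) B (inj₁ B<m)               = prefix⇒<columnLength c A B (inj₁ B<m)
  prefix⇒<columnLength (suc c) (suc A) B (inj₂ (B≡m , s<s A<c))   = prefix⇒<columnLength c A B (inj₂ (B≡m , A<c))

  columnLength-values : ∀ c A → columnLength c A ≡ m ⊎ (columnLength c A ≡ suc m × 0 < c)
  columnLength-values zero    A       = inj₁ refl
  columnLength-values (suc c) zero    = inj₂ (refl , z<s)
  columnLength-values (suc c) (suc A) with columnLength-values c A
  ... | inj₁ e       = inj₁ e
  ... | inj₂ (e , _) = inj₂ (e , z<s)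

  shape : Shape x y (x * m + c)
  shape = record
    { len₁        = λ b → rowLength m (toℕ b)
    ; len₂        = λ a → columnLength c (toℕ a)
    ; len₁≤x      = λ b → len₁≤x (toℕ b)
    ; len₂≤y      = λ a → len₂≤y (toℕ a)
    ; <len₁⇒<len₂ = λ a b a< → prefix⇒<columnLength c (toℕ a) (toℕ b) (<rowLength⇒prefix m (toℕ a) (toℕ b) a<)
    ; <len₂⇒<len₁ = λ a b b< → prefix⇒<rowLength m (toℕ a) (toℕ b) (toℕ<n a) (<columnLength⇒prefix c (toℕ a) (toℕ b) b<)
    ; len₁≢1      = λ 1<x b → len₁≢1 1<x (toℕ b)
    ; y∸len₂≢1    = λ 1<y a → y∸len₂≢1 1<y (toℕ a)
    ; enum        = rowMajor x y
    ; enum-<      = λ κ κ<s → prefix⇒<rowLength m _ _ (toℕ<n _)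
                      (<⇒rowMajorPrefix (toℕ<n _) c<x (subst (_< x * m + c) (toℕ-rowMajor x y κ) κ<s))
    ; enum-≥      = λ κ s≤κ κ∈ → <⇒≱ (rowMajorPrefix⇒< (toℕ<n _) (<rowLength⇒prefix m _ _ κ∈))
                      (subst (x * m + c ≤_) (toℕ-rowMajor x y κ) s≤κ)
    }
    where
    len₁≤x : ∀ B → rowLength m B ≤ x
    len₁≤x B with rowLength-values m B
    ... | inj₁ e         = ≤-reflexive e
    ... | inj₂ (inj₁ e)  = subst (_≤ x) (sym e) (<⇒≤ c<x)
    ... | inj₂ (inj₂ e)  = subst (_≤ x) (sym e) z≤n
    len₂≤y : ∀ A → columnLength c A ≤ y
    len₂≤y A with columnLength-values c A
    ... | inj₁ e          = subst (_≤ y) (sym e) m≤y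
    ... | inj₂ (e , 0<c)  = subst (_≤ y) (sym e) (m<y 0<c)
    len₁≢1 : 1 < x → ∀ B → rowLength m B ≢ 1
    len₁≢1 1<x B with rowLength-values m B
    ... | inj₁ e         = λ e′ → <-irrefl (trans (sym e′) e) 1<x
    ... | inj₂ (inj₁ e)  = λ e′ → c≢1 1<x (trans (sym e) e′)
    ... | inj₂ (inj₂ e)  = λ e′ → 0≢1+n (trans (sym e) e′)
    y∸len₂≢1 : 1 < y → ∀ A → y ∸ columnLength c A ≢ 1
    y∸len₂≢1 1<y A with columnLength-values c A
    ... | inj₁ e          = subst (λ q → y ∸ q ≢ 1) (sym e) (y∸m≢1 1<y)
    ... | inj₂ (e , 0<c)  = subst (λ q → y ∸ q ≢ 1) (sym e) (y∸m+1≢1 1<y 0<c)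

module Transposition {A : Set} (_≟_ : DecidableEquality A) (p q : A) (p≢q : p ≢ q) where

  transpose : A → A
  transpose t with t ≟ p | t ≟ q
  ... | yes _ | _     = q
  ... | no _  | yes _ = p
  ... | no _  | no _  = t

  transpose-cases : ∀ t → (t ≡ p × transpose t ≡ q) ⊎ (t ≡ q × transpose t ≡ p) ⊎ (t ≢ p × t ≢ q × transpose t ≡ t)
  transpose-cases t with t ≟ p | t ≟ q
  ... | yes t≡p | _       = inj₁ (t≡p , refl)
  ... | no _    | yes t≡q = inj₂ (inj₁ (t≡q , refl))
  ... | no t≢p  | no t≢q  = inj₂ (inj₂ (t≢p , t≢q , refl))

  transpose-p : transpose p ≡ q
  transpose-p with p ≟ p | p ≟ q
  ... | yes _   | _ = refl
  ... | no p≢p  | _ = ⊥-elim (p≢p refl)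

  transpose-q : transpose q ≡ p
  transpose-q with q ≟ p | q ≟ q
  ... | yes q≡p | _       = ⊥-elim (p≢q (sym q≡p))
  ... | no _    | yes _   = refl
  ... | no _    | no q≢q  = ⊥-elim (q≢q refl)

  transpose-involutive : ∀ t → transpose (transpose t) ≡ t
  transpose-involutive t with transpose-cases t
  ... | inj₁ (refl , e)         = trans (cong transpose e) transpose-q
  ... | inj₂ (inj₁ (refl , e))  = trans (cong transpose e) transpose-p
  ... | inj₂ (inj₂ (_ , _ , e)) = trans (cong transpose e) e

  transposition : A ↔ A
  transposition = mk↔ₛ′ transpose transpose transpose-involutive transpose-involutive

-- The first x (m₀ + 1) + 1 cells in row-major order, with the cell (x − 1 , m₀)
-- traded for (1 , m₀ + 1) so that no row contains a single cell.
ShiftedPrefix : (x m₀ A B : ℕ) → Set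
ShiftedPrefix x m₀ A B = B < m₀ ⊎ (B ≡ m₀ × A < x ∸ 1) ⊎ (B ≡ suc m₀ × A < 2)

module ShiftedShape (x y m₀ : ℕ) (3≤x : 3 ≤ x) (m₀+4≤y : m₀ + 4 ≤ y) where

  rowLength : ℕ → ℕ → ℕ
  rowLength zero    zero          = x ∸ 1
  rowLength zero    (suc zero)    = 2
  rowLength zero    (suc (suc B)) = 0
  rowLength (suc m) zero          = x
  rowLength (suc m) (suc B)       = rowLength m B

  <rowLength⇒shifted : ∀ m A B → A < rowLength m B → ShiftedPrefix x m A B
  <rowLength⇒shifted zero    A zero       A< = inj₂ (inj₁ (refl , A<))
  <rowLength⇒shifted zero    A (suc zero) A< = inj₂ (inj₂ (refl , A<))
  <rowLength⇒shifted (suc m) A zero       _  = inj₁ z<s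
  <rowLength⇒shifted (suc m) A (suc B)    A< with <rowLength⇒shifted m A B A<
  ... | inj₁ B<m               = inj₁ (s<s B<m)
  ... | inj₂ (inj₁ (e , A<))   = inj₂ (inj₁ (cong suc e , A<))
  ... | inj₂ (inj₂ (e , A<))   = inj₂ (inj₂ (cong suc e , A<))

  shifted⇒<rowLength : ∀ m A B → A < x → ShiftedPrefix x m A B → A < rowLength m B
  shifted⇒<rowLength zero    A zero          _   (inj₂ (inj₁ (_ , A<)))  = A<
  shifted⇒<rowLength zero    A (suc zero)    _   (inj₂ (inj₂ (_ , A<)))  = A<
  shifted⇒<rowLength zero    A (suc (suc B)) _   (inj₂ (inj₂ (e , _)))   = ⊥-elim (0≢1+n (sym (suc-injective e)))
  shifted⇒<rowLength (suc m) A zero          A<x _                       = A<x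
  shifted⇒<rowLength (suc m) A (suc B)       A<x (inj₁ (s<s B<m))        = shifted⇒<rowLength m A B A<x (inj₁ B<m)
  shifted⇒<rowLength (suc m) A (suc B)       A<x (inj₂ (inj₁ (e , A<)))  = shifted⇒<rowLength m A B A<x (inj₂ (inj₁ (suc-injective e , A<)))
  shifted⇒<rowLength (suc m) A (suc B)       A<x (inj₂ (inj₂ (e , A<)))  = shifted⇒<rowLength m A B A<x (inj₂ (inj₂ (suc-injective e , A<)))

  rowLength-values : ∀ m B → rowLength m B ≡ x ⊎ rowLength m B ≡ x ∸ 1 ⊎ rowLength m B ≡ 2 ⊎ rowLength m B ≡ 0
  rowLength-values zero    zero          = inj₂ (inj₁ refl)
  rowLength-values zero    (suc zero)    = inj₂ (inj₂ (inj₁ refl))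
  rowLength-values zero    (suc (suc B)) = inj₂ (inj₂ (inj₂ refl))
  rowLength-values (suc m) zero          = inj₁ refl
  rowLength-values (suc m) (suc B)       = rowLength-values m B

  columnLength : ℕ → ℕ
  columnLength A with A <? 2 | A ≟ x ∸ 1
  ... | yes _ | _     = suc (suc m₀)
  ... | no _  | yes _ = m₀
  ... | no _  | no _  = suc m₀

  2≤x∸1 : 2 ≤ x ∸ 1
  2≤x∸1 = ∸-monoˡ-≤ 1 3≤x

  <columnLength⇒shifted : ∀ A B → A < x → B < columnLength A → ShiftedPrefix x m₀ A B
  <columnLength⇒shifted A B A<x B< with A <? 2 | A ≟ x ∸ 1
  ... | yes A<2 | _ with m≤n⇒m<n∨m≡n (s≤s⁻¹ B<)
  ...   | inj₂ e = inj₂ (inj₂ (e , A<2))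
  ...   | inj₁ B<m₀+1 with m≤n⇒m<n∨m≡n (s≤s⁻¹ B<m₀+1)
  ...     | inj₁ B<m₀ = inj₁ B<m₀
  ...     | inj₂ e    = inj₂ (inj₁ (e , <-≤-trans A<2 2≤x∸1))
  <columnLength⇒shifted A B A<x B< | no _ | yes _ = inj₁ B<
  <columnLength⇒shifted A B A<x B< | no _ | no A≢x∸1 with m≤n⇒m<n∨m≡n (s≤s⁻¹ B<)
  ... | inj₁ B<m₀ = inj₁ B<m₀
  ... | inj₂ e    = inj₂ (inj₁ (e , ≤∧≢⇒< (∸-monoˡ-≤ 1 A<x) A≢x∸1))

  shifted⇒<columnLength : ∀ A B → ShiftedPrefix x m₀ A B → B < columnLength A
  shifted⇒<columnLength A B p with A <? 2 | A ≟ x ∸ 1 | p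
  ... | yes _   | _       | inj₁ B<m₀                 = m<n⇒m<1+n (m<n⇒m<1+n B<m₀)
  ... | yes _   | _       | inj₂ (inj₁ (refl , _))    = m<n⇒m<1+n (n<1+n _)
  ... | yes _   | _       | inj₂ (inj₂ (refl , _))    = n<1+n _
  ... | no _    | yes _   | inj₁ B<m₀                 = B<m₀
  ... | no _    | yes refl | inj₂ (inj₁ (_ , A<))     = ⊥-elim (<-irrefl refl A<)
  ... | no A≮2  | yes _   | inj₂ (inj₂ (_ , A<2))     = ⊥-elim (A≮2 A<2)
  ... | no _    | no _    | inj₁ B<m₀                 = m<n⇒m<1+n B<m₀
  ... | no _    | no _    | inj₂ (inj₁ (refl , _))    = n<1+n _
  ... | no A≮2  | no _    | inj₂ (inj₂ (_ , A<2))     = ⊥-elim (A≮2 A<2)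

  columnLength-values : ∀ A → columnLength A ≡ suc (suc m₀) ⊎ columnLength A ≡ m₀ ⊎ columnLength A ≡ suc m₀
  columnLength-values A with A <? 2 | A ≟ x ∸ 1
  ... | yes _ | _     = inj₁ refl
  ... | no _  | yes _ = inj₂ (inj₁ refl)
  ... | no _  | no _  = inj₂ (inj₂ refl)

  1<x : 1 < x
  1<x = ≤-trans (n≤1+n 2) 3≤x

  x∸1<x : x ∸ 1 < x
  x∸1<x = ∸-monoʳ-< {o = 0} z<s (<⇒≤ 1<x)

  m₀+i≤y : ∀ i → i ≤ 4 → m₀ + i ≤ y
  m₀+i≤y i i≤4 = ≤-trans (+-monoʳ-≤ m₀ i≤4) m₀+4≤y

  m₀<y : m₀ < y
  m₀<y = subst (_≤ y) (+-comm m₀ 1) (m₀+i≤y 1 (s≤s z≤n))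

  m₀+1<y : suc m₀ < y
  m₀+1<y = subst (_≤ y) (+-comm m₀ 2) (m₀+i≤y 2 (s≤s (s≤s z≤n)))

  C₁ C₂ : Cell x y
  C₁ = fromℕ< x∸1<x , fromℕ< m₀<y
  C₂ = fromℕ< 1<x , fromℕ< m₀+1<y

  C₁≢C₂ : C₁ ≢ C₂
  C₁≢C₂ e = <-irrefl (trans (sym (toℕ-fromℕ< m₀<y)) (trans (cong (toℕ ∘ proj₂) e) (toℕ-fromℕ< m₀+1<y))) (n<1+n m₀)

  open Transposition (≡-dec _≟ᶠ_ _≟ᶠ_) C₁ C₂ C₁≢C₂

  A′ B′ : Cell x y → ℕ
  A′ t = toℕ (proj₁ t)
  B′ t = toℕ (proj₂ t)

  ≡C : ∀ {t} C → A′ t ≡ A′ C → B′ t ≡ B′ C → t ≡ C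
  ≡C C eA eB = cong₂ _,_ (toℕ-injective eA) (toℕ-injective eB)

  Prefix Shifted : Cell x y → Set
  Prefix  t = RowMajorPrefix (suc m₀) 1 (A′ t) (B′ t)
  Shifted t = ShiftedPrefix x m₀ (A′ t) (B′ t)

  A′C₁ : A′ C₁ ≡ x ∸ 1
  A′C₁ = toℕ-fromℕ< x∸1<x
  B′C₁ : B′ C₁ ≡ m₀
  B′C₁ = toℕ-fromℕ< m₀<y
  A′C₂ : A′ C₂ ≡ 1
  A′C₂ = toℕ-fromℕ< 1<x
  B′C₂ : B′ C₂ ≡ suc m₀
  B′C₂ = toℕ-fromℕ< m₀+1<y

  prefix-C₁ : Prefix C₁
  prefix-C₁ = inj₁ (subst (_< suc m₀) (sym B′C₁) (n<1+n m₀))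

  ¬prefix-C₂ : ¬ Prefix C₂
  ¬prefix-C₂ (inj₁ B<) = <-irrefl B′C₂ B<
  ¬prefix-C₂ (inj₂ (_ , A<1)) = <-irrefl refl (subst (_< 1) A′C₂ A<1)

  shifted-C₂ : Shifted C₂
  shifted-C₂ = inj₂ (inj₂ (B′C₂ , subst (_< 2) (sym A′C₂) (n<1+n 1)))

  ¬shifted-C₁ : ¬ Shifted C₁
  ¬shifted-C₁ (inj₁ B<)                 = <-irrefl B′C₁ B<
  ¬shifted-C₁ (inj₂ (inj₁ (_ , A<)))    = <-irrefl A′C₁ A<
  ¬shifted-C₁ (inj₂ (inj₂ (B≡ , _)))    = <-irrefl (trans (sym B′C₁) B≡) (n<1+n m₀)

  prefix⇒shifted-other : ∀ t → t ≢ C₁ → Prefix t → Shifted t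
  prefix⇒shifted-other t t≢C₁ (inj₂ (B≡ , A<1)) = inj₂ (inj₂ (B≡ , <-trans A<1 (n<1+n 1)))
  prefix⇒shifted-other t t≢C₁ (inj₁ B<m₀+1) with m≤n⇒m<n∨m≡n (s≤s⁻¹ B<m₀+1)
  ... | inj₁ B<m₀ = inj₁ B<m₀
  ... | inj₂ B≡m₀ = inj₂ (inj₁ (B≡m₀ , ≤∧≢⇒< (∸-monoˡ-≤ 1 (toℕ<n (proj₁ t)))
                      (λ A≡ → t≢C₁ (≡C C₁ (trans A≡ (sym A′C₁)) (trans B≡m₀ (sym B′C₁))))))

  shifted⇒prefix-other : ∀ t → t ≢ C₂ → Shifted t → Prefix t
  shifted⇒prefix-other t _ (inj₁ B<m₀)              = inj₁ (m<n⇒m<1+n B<m₀)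
  shifted⇒prefix-other t _ (inj₂ (inj₁ (B≡m₀ , _))) = inj₁ (subst (_< suc m₀) (sym B≡m₀) (n<1+n m₀))
  shifted⇒prefix-other t t≢C₂ (inj₂ (inj₂ (B≡ , A<2))) = inj₂ (B≡ , A<1 (A′ t) refl A<2)
    where
    A<1 : ∀ a → A′ t ≡ a → a < 2 → a < 1
    A<1 zero          _  _ = z<s
    A<1 (suc zero)    A≡ _ = ⊥-elim (t≢C₂ (≡C C₂ (trans A≡ (sym A′C₂)) (trans B≡ (sym B′C₂))))
    A<1 (suc (suc a)) _  (s<s (s<s ()))

  prefix⇒shifted : ∀ t → Prefix t → Shifted (transpose t)
  prefix⇒shifted t p with transpose-cases t
  ... | inj₁ (_ , e)                = subst Shifted (sym e) shifted-C₂
  ... | inj₂ (inj₁ (refl , _))      = ⊥-elim (¬prefix-C₂ p)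
  ... | inj₂ (inj₂ (t≢C₁ , _ , e))  = subst Shifted (sym e) (prefix⇒shifted-other t t≢C₁ p)

  shifted⇒prefix : ∀ t → Shifted (transpose t) → Prefix t
  shifted⇒prefix t p with transpose-cases t
  ... | inj₁ (refl , _)             = prefix-C₁
  ... | inj₂ (inj₁ (_ , e))         = ⊥-elim (¬shifted-C₁ (subst Shifted e p))
  ... | inj₂ (inj₂ (_ , t≢C₂ , e))  = shifted⇒prefix-other t t≢C₂ (subst Shifted e p)

  shape : Shape x y (x * suc m₀ + 1)
  shape = record
    { len₁        = λ b → rowLength m₀ (toℕ b)
    ; len₂        = λ a → columnLength (toℕ a)
    ; len₁≤x      = λ b → len₁≤x (toℕ b)
    ; len₂≤y      = λ a → len₂≤y (toℕ a)
    ; <len₁⇒<len₂ = λ a b a< → shifted⇒<columnLength (toℕ a) (toℕ b) (<rowLength⇒shifted m₀ (toℕ a) (toℕ b) a<)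
    ; <len₂⇒<len₁ = λ a b b< → shifted⇒<rowLength m₀ (toℕ a) (toℕ b) (toℕ<n a) (<columnLength⇒shifted (toℕ a) (toℕ b) (toℕ<n a) b<)
    ; len₁≢1      = λ _ b → len₁≢1 (toℕ b)
    ; y∸len₂≢1    = λ _ a → y∸len₂≢1 (toℕ a)
    ; enum        = transposition ↔-∘ rowMajor x y
    ; enum-<      = λ κ κ<s → shifted⇒<rowLength m₀ _ _ (toℕ<n _) (prefix⇒shifted (row κ)
                      (<⇒rowMajorPrefix (toℕ<n _) 1<x (subst (_< x * suc m₀ + 1) (toℕ-rowMajor x y κ) κ<s)))
    ; enum-≥      = λ κ s≤κ κ∈ → <⇒≱ (rowMajorPrefix⇒< (toℕ<n _) (shifted⇒prefix (row κ) (<rowLength⇒shifted m₀ _ _ κ∈)))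
                      (subst (x * suc m₀ + 1 ≤_) (toℕ-rowMajor x y κ) s≤κ)
    }
    where
    row = Inverse.to (rowMajor x y)
    len₁≤x : ∀ B → rowLength m₀ B ≤ x
    len₁≤x B with rowLength-values m₀ B
    ... | inj₁ e                = ≤-reflexive e
    ... | inj₂ (inj₁ e)         = subst (_≤ x) (sym e) (m∸n≤m x 1)
    ... | inj₂ (inj₂ (inj₁ e))  = subst (_≤ x) (sym e) 1<x
    ... | inj₂ (inj₂ (inj₂ e))  = subst (_≤ x) (sym e) z≤n
    len₂≤y : ∀ A → columnLength A ≤ y
    len₂≤y A with columnLength-values A
    ... | inj₁ e         = subst (_≤ y) (sym e) m₀+1<y
    ... | inj₂ (inj₁ e)  = subst (_≤ y) (sym e) (<⇒≤ m₀<y)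
    ... | inj₂ (inj₂ e)  = subst (_≤ y) (sym e) (<⇒≤ m₀+1<y)
    len₁≢1 : ∀ B → rowLength m₀ B ≢ 1
    len₁≢1 B with rowLength-values m₀ B
    ... | inj₁ e                = λ e′ → <-irrefl (trans (sym e′) e) 1<x
    ... | inj₂ (inj₁ e)         = λ e′ → <-irrefl (trans (sym e′) e) (<-≤-trans (s<s z<s) 2≤x∸1)
    ... | inj₂ (inj₂ (inj₁ e))  = λ e′ → <-irrefl (trans (sym e′) e) (s<s z<s)
    ... | inj₂ (inj₂ (inj₂ e))  = λ e′ → 0≢1+n (trans (sym e) e′)
    y∸≢1 : ∀ h → 2 + h ≤ y → y ∸ h ≢ 1
    y∸≢1 h 2+h≤y e = <-irrefl (sym e) (≤-trans (≤-reflexive (sym (m+n∸n≡m 2 h))) (∸-monoˡ-≤ h 2+h≤y))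
    2+m₀+i≤y : ∀ i → i ≤ 2 → 2 + (i + m₀) ≤ y
    2+m₀+i≤y i i≤2 = subst (_≤ y) (+-comm m₀ (2 + i)) (m₀+i≤y (2 + i) (+-monoʳ-≤ 2 i≤2))
    y∸len₂≢1 : ∀ A → y ∸ columnLength A ≢ 1
    y∸len₂≢1 A with columnLength-values A
    ... | inj₁ e         = subst (λ q → y ∸ q ≢ 1) (sym e) (y∸≢1 (suc (suc m₀)) (2+m₀+i≤y 2 ≤-refl))
    ... | inj₂ (inj₁ e)  = subst (λ q → y ∸ q ≢ 1) (sym e) (y∸≢1 m₀ (2+m₀+i≤y 0 z≤n))
    ... | inj₂ (inj₂ e)  = subst (λ q → y ∸ q ≢ 1) (sym e) (y∸≢1 (suc m₀) (2+m₀+i≤y 1 (s≤s z≤n)))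

∸≢1 : ∀ {N s} → s ≤ N → s ≢ N ∸ 1 → N ∸ s ≢ 1
∸≢1 {N} {s} s≤N s≢N∸1 N∸s≡1 = s≢N∸1 (begin
  s                  ≡⟨ m+n∸n≡m s 1 ⟨
  s + 1 ∸ 1          ≡⟨ cong (λ z → s + z ∸ 1) N∸s≡1 ⟨
  s + (N ∸ s) ∸ 1    ≡⟨ cong (_∸ 1) (m+[n∸m]≡n s≤N) ⟩
  N ∸ 1              ∎)

thinShape : ∀ y s → s ≤ y → y ∸ s ≢ 1 → Shape 1 y s
thinShape y s s≤y y∸s≢1 = subst (Shape 1 y) (trans (+-identityʳ _) (+-identityʳ s))
  (RowMajorShape.shape 1 y s 0 z<s (λ 1<1 → ⊥-elim (<-irrefl refl 1<1)) s≤y (λ ()) (λ _ → y∸s≢1) (λ _ ()))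

y∸j≢1 : ∀ y j → 2 ≤ y → j ≤ y ∸ 2 → y ∸ j ≢ 1
y∸j≢1 y j 2≤y j≤ y∸j≡1 = <-irrefl (sym y∸j≡1) (≤-trans (≤-reflexive (sym (m∸[m∸n]≡n 2≤y))) (∸-monoʳ-≤ y j≤))

rowsShape : ∀ x y s .{{_ : NonZero x}} → 3 ≤ x → 3 ≤ y → s ≤ x * (y ∸ 2) → s ≢ 1 → Shape x y s
rowsShape x y s 3≤x 3≤y s≤ s≢1 with s % x ≟ 1
... | no c≢1 = subst (Shape x y) (sym s≡) (RowMajorShape.shape x y m c (m%n<n s x) (λ _ → c≢1) m≤y m<y
                 (λ _ → y∸j≢1 y m 2≤y m≤y∸2) (λ _ 0<c → y∸j≢1 y (suc m) 2≤y (m+1≤y∸2 0<c)))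
  where
  m = s / x
  c = s % x
  2≤y = ≤-trans (n≤1+n 2) 3≤y
  s≡ : s ≡ x * m + c
  s≡ = trans (m≡m%n+[m/n]*n s x) (trans (+-comm c (m * x)) (cong (_+ c) (*-comm m x)))
  m≤y∸2 : m ≤ y ∸ 2
  m≤y∸2 = *-cancelˡ-≤ x (≤-trans (subst (x * m ≤_) (sym s≡) (m≤m+n (x * m) c)) s≤)
  m≤y = ≤-trans m≤y∸2 (m∸n≤m y 2)
  m+1≤y∸2 : 0 < c → suc m ≤ y ∸ 2
  m+1≤y∸2 0<c = *-cancelˡ-< x m (y ∸ 2) (<-≤-trans (subst (x * m <_) (sym s≡) (m<m+n (x * m) 0<c)) s≤)
  m<y : 0 < c → m < y
  m<y 0<c = ≤-trans (m+1≤y∸2 0<c) (m∸n≤m y 2)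
... | yes c≡1 = shifted (s / x) refl
  where
  s≡ : ∀ {m} → s / x ≡ m → s ≡ x * m + 1
  s≡ refl = trans (m≡m%n+[m/n]*n s x) (trans (+-comm (s % x) _) (cong₂ _+_ (*-comm (s / x) x) c≡1))
  shifted : ∀ m → s / x ≡ m → Shape x y s
  shifted zero      m≡0 = ⊥-elim (s≢1 (trans (s≡ m≡0) (cong (_+ 1) (*-zeroʳ x))))
  shifted (suc m₀)  m≡ = subst (Shape x y) (sym (s≡ m≡)) (ShiftedShape.shape x y m₀ 3≤x m₀+4≤y)
    where
    m₀+1<y∸2 : suc m₀ < y ∸ 2
    m₀+1<y∸2 = *-cancelˡ-< x (suc m₀) (y ∸ 2) (<-≤-trans (subst (x * suc m₀ <_) (sym (s≡ m≡)) (m<m+n (x * suc m₀) z<s)) s≤)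
    m₀+4≤y : m₀ + 4 ≤ y
    m₀+4≤y = ≤-trans (≤-reflexive (+-comm m₀ 4))
      (≤-trans (+-monoʳ-≤ 2 m₀+1<y∸2) (≤-reflexive (m+[n∸m]≡n (≤-trans (n≤1+n 2) 3≤y))))

fullShape : ∀ x → .{{NonZero x}} → Shape x x (x * x)
fullShape x@(suc _) = subst (Shape x x) (+-identityʳ (x * x))
  (RowMajorShape.shape x x x 0 z<s (λ _ ()) ≤-refl (λ ()) (λ _ x∸x≡1 → 0≢1+n (trans (sym (n∸n≡0 x)) x∸x≡1)) (λ _ ()))

-- For y = x both kinds of factors have length xn, so any split of the x² factors works.
squareDecomposition : ∀ h k s → let x = suc (2 * h) in
  s ≤ x * x → Decomposition (x * x) (levels k) s (x * levels k) (x * x ∸ s) (x * levels k)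
squareDecomposition h k s = fromFullShape (fullShape (suc (2 * h)))
  where
  x = suc (2 * h)
  fromFullShape : Shape x x (x * x) → s ≤ x * x → Decomposition (x * x) (levels k) s (x * levels k) (x * x ∸ s) (x * levels k)
  fromFullShape S s≤xx = decomposition partition (enum ↔-∘ split)
    (λ i → all-long (Inverse.to split (inj₁ i))) (λ j → all-long (Inverse.to split (inj₂ j)))
    where
    open ShapeFactors h h k (x * x) S using (partition; factor; cyclesA; n)
    open Shape S using (enum; enum-<)
    split : (Fin s ⊎ Fin (x * x ∸ s)) ↔ Fin (x * x)
    split = threshold (m+[n∸m]≡n s≤xx)
    all-long : ∀ κ → UniformCycles (factor (Inverse.to enum κ)) (x * n)
    all-long κ = cyclesA (Inverse.to enum κ) (enum-< κ (toℕ<n κ))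

neither-fits : ∀ a b s → s ≤ (3 + a) * (3 + b) → (3 + a) * (1 + b) < s → (3 + b) * (1 + a) < (3 + a) * (3 + b) ∸ s →
  a + b + a * b ≤ 1
neither-fits a b s s≤ s> r> = +-cancelˡ-≤ xy _ _ (subst (_≤ xy + 1) (identity a b) (+-monoˡ-≤ 1 u+v+2≤xy))
  where
  xy = (3 + a) * (3 + b)
  u = (3 + a) * (1 + b)
  v = (3 + b) * (1 + a)
  u+v+2≤xy : u + v + 2 ≤ xy
  u+v+2≤xy = subst₂ _≤_ (shuffle u v) (m+[n∸m]≡n s≤) (+-mono-≤ s> r>)
    where
    shuffle : ∀ u v → suc u + suc v ≡ u + v + 2
    shuffle = solve-∀
  identity : ∀ a b → (3 + a) * (1 + b) + (3 + b) * (1 + a) + 2 + 1 ≡ (3 + a) * (3 + b) + (a + b + a * b)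
  identity = solve-∀

3+2h≡odd : ∀ h → suc (2 * suc h) ≡ 3 + (h + h)
3+2h≡odd h = cong (λ m → 2 + m) (trans (+-suc h (h + 0)) (cong (λ m → suc (h + m)) (+-identityʳ h)))

3≤odd : ∀ h → 3 ≤ suc (2 * suc h)
3≤odd h = subst (3 ≤_) (sym (3+2h≡odd h)) (s≤s (s≤s (s≤s z≤n)))

h+h≤1⇒h≡0 : ∀ h → h + h ≤ 1 → h ≡ 0
h+h≤1⇒h≡0 zero    _ = refl
h+h≤1⇒h≡0 (suc h) (s≤s h+1+h≤0) with subst (_≤ 0) (+-suc h h) h+1+h≤0
... | ()

module DecompositionCases (k s : ℕ) (s≢1 : s ≢ 1) where

  Goal : ℕ → ℕ → Set
  Goal x y = Decomposition (x * y) (levels k) s (x * levels k) (x * y ∸ s) (y * levels k)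

  case-1×y : ∀ hy → let y = suc (2 * hy) in s ≤ 1 * y → s ≢ 1 * y ∸ 1 → Goal 1 y
  case-1×y hy s≤1y s≢1y∸1 = shapeDecomposition 0 hy k s (thinShape y s s≤y (∸≢1 s≤y s≢y∸1)) s≤1y
    where
    y = suc (2 * hy)
    s≤y = subst (s ≤_) (*-identityˡ y) s≤1y
    s≢y∸1 = λ s≡y∸1 → s≢1y∸1 (trans s≡y∸1 (cong (_∸ 1) (sym (*-identityˡ y))))

  case-x×1 : ∀ hx → let x = suc (2 * hx) in s ≤ x * 1 → Goal x 1
  case-x×1 hx s≤x = Decomposition-transpose {suc (2 * hx)} {1} {levels k} s≤x
    (shapeDecomposition 0 hx k r (thinShape x r r≤x x∸r≢1) (subst (r ≤_) (sym (+-identityʳ x)) r≤x))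
    where
    x = suc (2 * hx)
    r = x * 1 ∸ s
    x*1≡x = *-identityʳ x
    r≤x : r ≤ x
    r≤x = ≤-trans (m∸n≤m (x * 1) s) (≤-reflexive x*1≡x)
    x∸r≢1 : x ∸ r ≢ 1
    x∸r≢1 x∸r≡1 = s≢1 (trans (sym (m∸[m∸n]≡n s≤x)) (trans (cong (_∸ r) x*1≡x) x∸r≡1))

  module Large (a b : ℕ) (s≤xy : s ≤ suc (2 * suc a) * suc (2 * suc b)) (s≢xy∸1 : s ≢ suc (2 * suc a) * suc (2 * suc b) ∸ 1) where

    x y r : ℕ
    x = suc (2 * suc a)
    y = suc (2 * suc b)
    r = x * y ∸ s

    byRows : s ≤ x * (y ∸ 2) → Goal x y
    byRows fits = shapeDecomposition (suc a) (suc b) k s (rowsShape x y s (3≤odd a) (3≤odd b) fits s≢1) s≤xy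

    byColumns : r ≤ y * (x ∸ 2) → Goal x y
    byColumns fits = Decomposition-transpose s≤xy (shapeDecomposition (suc b) (suc a) k r
      (rowsShape y x r (3≤odd b) (3≤odd a) fits (∸≢1 s≤xy s≢xy∸1)) (subst (r ≤_) (*-comm x y) (m∸n≤m (x * y) s)))

    -- When neither fits, x = y = 3.
    bySquare : x * (y ∸ 2) < s → y * (x ∸ 2) < r → Goal x y
    bySquare s> r> = subst₂ Goal (sym x≡3) (sym y≡3) (squareDecomposition 1 k s (subst₂ (λ p q → s ≤ p * q) x≡3 y≡3 s≤xy))
      where
      a+b+ab≤1 = neither-fits (a + a) (b + b) s
        (subst₂ (λ p q → s ≤ p * q) (3+2h≡odd a) (3+2h≡odd b) s≤xy)
        (subst₂ (λ p q → p * (q ∸ 2) < s) (3+2h≡odd a) (3+2h≡odd b) s>)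
        (subst₂ (λ p q → q * (p ∸ 2) < p * q ∸ s) (3+2h≡odd a) (3+2h≡odd b) r>)
      a+b≤1 = ≤-trans (m≤m+n ((a + a) + (b + b)) ((a + a) * (b + b))) a+b+ab≤1
      x≡3 = cong (λ a → suc (2 * suc a)) (h+h≤1⇒h≡0 a (≤-trans (m≤m+n (a + a) (b + b)) a+b≤1))
      y≡3 = cong (λ b → suc (2 * suc b)) (h+h≤1⇒h≡0 b (≤-trans (m≤n+m (b + b) (a + a)) a+b≤1))

    case-large : Goal x y
    case-large with s ≤? x * (y ∸ 2) | r ≤? y * (x ∸ 2)
    ... | yes fits | _        = byRows fits
    ... | no _     | yes fits = byColumns fits
    ... | no s≰    | no r≰    = bySquare (≰⇒> s≰) (≰⇒> r≰)

oddDecomposition : ∀ hx hy k s → let x = suc (2 * hx) ; y = suc (2 * hy) in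
  s ≤ x * y → s ≢ 1 → s ≢ x * y ∸ 1 → Decomposition (x * y) (levels k) s (x * levels k) (x * y ∸ s) (y * levels k)
oddDecomposition zero       hy       k s s≤ s≢1 s≢xy∸1 = DecompositionCases.case-1×y k s s≢1 hy s≤ s≢xy∸1
oddDecomposition (suc hx)   zero     k s s≤ s≢1 _      = DecompositionCases.case-x×1 k s s≢1 (suc hx) s≤
oddDecomposition (suc hx)   (suc hy) k s s≤ s≢1 s≢xy∸1 = DecompositionCases.Large.case-large k s s≢1 hx hy s≤ s≢xy∸1

levels≡ : ∀ k → levels k ≡ suc (2 * suc k)
levels≡ k = sym (3+2h≡odd k)

lemma7p5 : (x y n sₚ : ℕ) → Odd x → Odd y → Odd n → 3 ≤ n
    → sₚ ≤ x * y → sₚ ≢ 1 → sₚ ≢ x * y ∸ 1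
    → Decomposition (x * y) n sₚ (x * n) (x * y ∸ sₚ) (y * n)
lemma7p5 _ _ _ s (hx , refl) (hy , refl) (zero , refl) (s≤s ())
lemma7p5 x y _ s (hx , refl) (hy , refl) (suc k , refl) _ s≤ s≢1 s≢xy∸1 =
  subst (λ n → Decomposition (x * y) n s (x * n) (x * y ∸ s) (y * n)) (levels≡ k) (oddDecomposition hx hy k s s≤ s≢1 s≢xy∸1)
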